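{- Let $\mathbf c\in\mathbb Z_{\ge0}^n$ and let $M$ be a proper $\mathbf c$-multicomplex. Then (i) $h_i(\mathcal B_{\mathbf c}(M))=f_i(M)$ for all $i$; (ii) $g_i(\mathrm{Bier}_{\mathbf c}(M))=f_i(M)-f_{|\mathbf c|-i}(M)$ for $i=0,1,\dots,\lfloor(|\mathbf c|-1)/2\rfloor$.
   Context: Fix $\mathbf c=(c_1,\dots,c_n)\in\mathbb Z_{\ge0}^n$, $|\mathbf c|=c_1+\cdots+c_n$, and write $x^{\mathbf a}=x_1^{a_1}\cdots x_n^{a_n}$. A $\mathbf c$-monomial is $x^{\mathbf a}$ with $a_i\le c_i$ for all $i$. A $\mathbf c$-multicomplex is a nonempty set $M$ of $\mathbf c$-monomials closed under taking divisors; it is proper if it is not the set of all $\mathbf c$-monomials. $f_i(M)$ denotes the number of monomials of degree $i$ in $M$. Let $\widetilde X=\{x_i^{(j)}:1\le i\le n,\ 0\le j\le c_i\}$ (new symbols). For a $\mathbf c$-monomial $x^{\mathbf a}$ put $F_{\mathbf c}(x^{\mathbf a})=\widetilde X\setminus\{x_1^{(a_1)},\dots,x_n^{(a_n)}\}$; $\mathcal B_{\mathbf c}(M)$ is the simplicial complex consisting of all subsets of the sets $F_{\mathbf c}(x^{\mathbf a})$, $x^{\mathbf a}\in M$ (it has dimension $|\mathbf c|-1$). For a pure $(d-1)$-dimensional complex $B$, $\partial B$ is the complex generated by the $(d-1)$-element faces lying in exactly one facet. For proper $M$, $\mathrm{Bier}_{\mathbf c}(M)=\partial\mathcal B_{\mathbf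 c}(M)$ (of dimension $|\mathbf c|-2$). For a $(d-1)$-dimensional simplicial complex $\Delta$ with $f_i$ faces of cardinality $i$ ($f_0=1$), the $h$-vector $(h_0,\dots,h_d)$ is defined by $\sum_{i=0}^d h_it^{d-i}=\sum_{i=0}^d f_i(t-1)^{d-i}$, and the $g$-vector by $g_0=1$, $g_i=h_i-h_{i-1}$ for $1\le i\le\lfloor d/2\rfloor$. -}

module Defs where

open import Data.Nat using (ℕ; zero; suc; _+_; _∸_; _≤_; _≡ᵇ_)
open import Data.Nat.Combinatorics using (_C_)
open import Data.Integer as ℤ using (ℤ; +_; -_)
open import Data.Bool using (Bool; true; false; _∧_; _∨_; not; if_then_else_)
open import Data.Fin using (Fin; toℕ)
open import Data.List as List using (List; []; _∷_; [_]; concatMap; upTo; map)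
open import Data.Bool.ListAction using (any; all)
open import Data.Vec as Vec using (Vec; []; _∷_; _++_; tabulate)
open import Data.Vec.Relation.Binary.Pointwise.Inductive using (Pointwise)
open import Data.Fin.Subset using (Subset; ∣_∣)
open import Data.Product using (Σ; _×_; ∃)
open import Relation.Binary.PropositionalEquality using (_≡_)
open import Relation.Nullary using (¬_)

countᵇ : {A : Set} → (A → Bool) → List A → ℕ
countᵇ p []       = 0
countᵇ p (x ∷ xs) = (if p x then 1 else 0) + countᵇ p xs

sumTo : ℕ → (ℕ → ℤ) → ℤ
sumTo zero    f = f 0
sumTo (suc k) f = sumTo k f ℤ.+ f (suc k)

allSubsets : (N : ℕ) → List (Subset N)
allSubsets zero    = [ [] ]
allSubsets (suc N) = concatMap (λ s → (Vec._∷_ false s) List.∷ (Vec._∷_ true s) List.∷ List.[]) (allSubsets N)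

_⊆ᵇ_ : {N : ℕ} → Subset N → Subset N → Bool
[]       ⊆ᵇ []       = true
(x ∷ xs) ⊆ᵇ (y ∷ ys) = (not x ∨ y) ∧ (xs ⊆ᵇ ys)

_=ᵇ_ : {N : ℕ} → Subset N → Subset N → Bool
s =ᵇ t = (s ⊆ᵇ t) ∧ (t ⊆ᵇ s)

-- A (finite) set family on the vertex set Fin N, given by its (decidable)
-- membership test.  A simplicial complex is such a family closed under subsets;
-- all families below are of this form by construction.
Family : ℕ → Set
Family N = Subset N → Bool

-- f_k : number of faces of cardinality k
fFam : {N : ℕ} → Family N → ℕ → ℕ
fFam {N} Δ k = countᵇ (λ σ → Δ σ ∧ (∣ σ ∣ ≡ᵇ k)) (allSubsets N)

isFacet : {N : ℕ} → Family N → Subset N → Bool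
isFacet {N} Δ S = Δ S ∧ all (λ T → not (Δ T ∧ (S ⊆ᵇ T)) ∨ (T =ᵇ S)) (allSubsets N)

boundary : {N : ℕ} → ℕ → Family N → Family N
boundary {N} d Δ σ =
  any (λ τ → (∣ τ ∣ ≡ᵇ (d ∸ 1)) ∧ Δ τ
           ∧ (countᵇ (λ S → isFacet Δ S ∧ (τ ⊆ᵇ S)) (allSubsets N) ≡ᵇ 1)
           ∧ (σ ⊆ᵇ τ))
      (allSubsets N)

-- h-vector of a (d-1)-dimensional complex with f-vector f:
--   Σ_i h_i t^{d-i} = Σ_i f_i (t-1)^{d-i};
-- h_k is the coefficient of t^{d-k} on the right, i.e.
--   h_k = Σ_{i=0}^{k} (-1)^{k-i} C(d-i, k-i) f_i      (0 ≤ k ≤ d)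
sign : ℕ → ℤ
sign zero    = + 1
sign (suc m) = - sign m

hVec : ℕ → (ℕ → ℕ) → ℕ → ℤ
hVec d f k = sumTo k (λ i → sign (k ∸ i) ℤ.* (+ (((d ∸ i) C (k ∸ i)) Data.Nat.* f i)))
  where import Data.Nat

gVec : ℕ → (ℕ → ℕ) → ℕ → ℤ
gVec d f zero    = + 1
gVec d f (suc i) = hVec d f (suc i) ℤ.- hVec d f i

∣_∣ᶜ : {n : ℕ} → Vec ℕ n → ℕ
∣ c ∣ᶜ = Vec.sum c

IsCMono : {n : ℕ} → Vec ℕ n → Vec ℕ n → Set
IsCMono c a = Pointwise _≤_ a c

_∣ᵐ_ : {n : ℕ} → Vec ℕ n → Vec ℕ n → Set
a ∣ᵐ b = Pointwise _≤_ a b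

deg : {n : ℕ} → Vec ℕ n → ℕ
deg a = Vec.sum a

_∈ᵐ_ : {n : ℕ} → Vec ℕ n → (Vec ℕ n → Bool) → Set
a ∈ᵐ M = M a ≡ true

record IsCMulticomplex {n : ℕ} (c : Vec ℕ n) (M : Vec ℕ n → Bool) : Set where
  field
    onlyCMonos : ∀ a → a ∈ᵐ M → IsCMono c a
    divClosed  : ∀ a b → b ∈ᵐ M → a ∣ᵐ b → a ∈ᵐ M
    nonempty   : ∃ λ a → a ∈ᵐ M

IsProper : {n : ℕ} (c : Vec ℕ n) (M : Vec ℕ n → Bool) → Set
IsProper c M = ∃ λ a → IsCMono c a × ¬ (a ∈ᵐ M)

cMonos : {n : ℕ} → Vec ℕ n → List (Vec ℕ n)
cMonos []       = [ [] ]
cMonos (c ∷ cs) = concatMap (λ x → map (x ∷_) (cMonos cs)) (upTo (suc c))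

fM : {n : ℕ} → Vec ℕ n → (Vec ℕ n → Bool) → ℕ → ℕ
fM c M i = countᵇ (λ a → M a ∧ (deg a ≡ᵇ i)) (cMonos c)

-- The vertex set X̃ = {x_i^(j) : 1 ≤ i ≤ n, 0 ≤ j ≤ c_i}, flattened to
-- Fin (Σ_i (c_i + 1)): the block of x_1^(0..c_1) first, then x_2^(...), etc.

Xsize : {n : ℕ} → Vec ℕ n → ℕ
Xsize []       = 0
Xsize (c ∷ cs) = suc c + Xsize cs

Fc : {n : ℕ} → (c a : Vec ℕ n) → Subset (Xsize c)
Fc []       []       = []
Fc (c ∷ cs) (a ∷ as) = tabulate (λ (j : Fin (suc c)) → not (toℕ j ≡ᵇ a)) ++ Fc cs as

Bc : {n : ℕ} → (c : Vec ℕ n) → (Vec ℕ n → Bool) → Family (Xsize c)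
Bc c M σ = any (λ a → M a ∧ (σ ⊆ᵇ Fc c a)) (cMonos c)

-- Bier_c(M) = ∂ B_c(M)   (B_c(M) is pure of dimension |c| - 1)
Bier : {n : ℕ} → (c : Vec ℕ n) → (Vec ℕ n → Bool) → Family (Xsize c)
Bier c M = boundary ∣ c ∣ᶜ (Bc c M)

module Submission where

-- For a face σ ⊆ X̃ let lo σ (resp. hi σ) be the monomial whose i-th exponent is
-- the first (resp. last) index j with x_i^(j) ∉ σ.  The combinatorial heart is
--   σ ∈ B_c(M)     ⇔ lo σ ∈ M,                     (Characterisation.Bc≡M∘lo)
--   σ ∈ Bier_c(M)  ⇔ lo σ ∈ M and hi σ ∉ M,        (Characterisation.Bier≡)
-- proved from the facts that the facets of B_c(M) are the F_c(a), a ∈ M, and that a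
-- (C-1)-face in exactly one facet is obtained from some F_c(a), a ∈ M, by removing one
-- more vertex x_j^(q) with a[j]≔q ∉ M (Ridges).  Counting faces of each size through
-- lo and hi (FaceCounts) writes f(B_c(M)) and f(B_c(M)) - f(Bier_c(M)) as combinations,
-- weighted by f(M), of shifted binomial sequences l ↦ C(D-i, l-i) (FVectors).  The
-- h-vector of such a sequence is the indicator of i (HVectors.hVec-sbin), which gives
-- (i) and, h being additive, h_i(Bier_c(M)) = f_i(M) - f_{C-i}(M); since the g-vector
-- in dimension C-1 is the h-vector in dimension C (HVectors.g≡h-suc), this gives (ii).

open import Defs
open import Data.Nat using (ℕ)
open import Data.Bool using (Bool)
open import Data.Vec using (Vec)
open import Relation.Binary.PropositionalEquality

module Booleans where

  open import Data.Nat using (zero; suc; _*_; _≡ᵇ_)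
  open import Data.Nat.Properties using (suc-injective; +-identityʳ)
  open import Data.Empty using (⊥-elim)
  open import Data.Bool using (true; false; _∧_; _∨_; not; if_then_else_)
  open import Relation.Nullary using (¬_)
  open import Data.List using (List; []; _∷_)
  open import Data.Bool.ListAction using (any; all)
  open import Data.List.Membership.Propositional using (_∈_)
  open import Data.List.Relation.Unary.Any using (here; there)
  open import Data.Product using (Σ; _×_; _,_)

  𝟙 : Bool → ℕ
  𝟙 b = if b then 1 else 0

  𝟙-∧ : ∀ x y → 𝟙 (x ∧ y) ≡ 𝟙 x * 𝟙 y
  𝟙-∧ true  y = sym (+-identityʳ (𝟙 y))
  𝟙-∧ false y = refl

  𝟙-∧-* : ∀ x y z → 𝟙 (x ∧ y) * z ≡ 𝟙 x * (𝟙 y * z)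
  𝟙-∧-* true  y z = sym (+-identityʳ (𝟙 y * z))
  𝟙-∧-* false y z = refl

  𝟙-∧-middle : ∀ p x y → 𝟙 (p ∧ (x ∧ y)) ≡ 𝟙 x * 𝟙 (p ∧ y)
  𝟙-∧-middle true  true  y = sym (+-identityʳ (𝟙 y))
  𝟙-∧-middle true  false y = refl
  𝟙-∧-middle false true  y = refl
  𝟙-∧-middle false false y = refl

  ∧-trueˡ : ∀ {x y} → x ∧ y ≡ true → x ≡ true
  ∧-trueˡ {true} _ = refl

  ∧-trueʳ : ∀ {x y} → x ∧ y ≡ true → y ≡ true
  ∧-trueʳ {true} p = p

  ∧-true : ∀ {x y} → x ≡ true → y ≡ true → x ∧ y ≡ true
  ∧-true refl refl = refl

  ⇒-elim : ∀ {x y} → x ≡ true → not x ∨ y ≡ true → y ≡ true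
  ⇒-elim refl p = p

  ⇒-intro : ∀ x {y} → (x ≡ true → y ≡ true) → not x ∨ y ≡ true
  ⇒-intro true  f = f refl
  ⇒-intro false f = refl

  not-true : ∀ {x} → not x ≡ true → x ≡ false
  not-true {false} _ = refl

  bool-ext : ∀ {b b' : Bool} → (b ≡ true → b' ≡ true) → (b' ≡ true → b ≡ true) → b ≡ b'
  bool-ext {true}  {true}  f g = refl
  bool-ext {true}  {false} f g = sym (f refl)
  bool-ext {false} {true}  f g = g refl
  bool-ext {false} {false} f g = refl

  ≡ᵇ-true⇒≡ : ∀ m n → (m ≡ᵇ n) ≡ true → m ≡ n
  ≡ᵇ-true⇒≡ zero    zero    _ = refl
  ≡ᵇ-true⇒≡ (suc m) (suc n) p = cong suc (≡ᵇ-true⇒≡ m n p)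

  ≡⇒≡ᵇ-true : ∀ m n → m ≡ n → (m ≡ᵇ n) ≡ true
  ≡⇒≡ᵇ-true zero    zero    _ = refl
  ≡⇒≡ᵇ-true (suc m) (suc n) e = ≡⇒≡ᵇ-true m n (suc-injective e)

  ≢⇒≡ᵇ-false : ∀ m n → ¬ m ≡ n → (m ≡ᵇ n) ≡ false
  ≢⇒≡ᵇ-false m n ne = bool-ext (λ p → ⊥-elim (ne (≡ᵇ-true⇒≡ m n p))) (λ ())

  ≡ᵇ-sym : ∀ m n → (m ≡ᵇ n) ≡ (n ≡ᵇ m)
  ≡ᵇ-sym m n = bool-ext (λ p → ≡⇒≡ᵇ-true n m (sym (≡ᵇ-true⇒≡ m n p)))
                        (λ p → ≡⇒≡ᵇ-true m n (sym (≡ᵇ-true⇒≡ n m p)))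

  any-intro : {A : Set} (p : A → Bool) (xs : List A) (x : A) → x ∈ xs → p x ≡ true → any p xs ≡ true
  any-intro p (y ∷ xs) x (here refl) px rewrite px = refl
  any-intro p (y ∷ xs) x (there x∈) px with p y
  ... | true  = refl
  ... | false = any-intro p xs x x∈ px

  any-elim : {A : Set} (p : A → Bool) (xs : List A) → any p xs ≡ true → Σ A λ x → x ∈ xs × p x ≡ true
  any-elim p (y ∷ xs) h with p y in eq
  ... | true  = y , here refl , eq
  ... | false with any-elim p xs h
  ...   | x , x∈ , px = x , there x∈ , px

  any-cong : {A : Set} (p q : A → Bool) (xs : List A) → (∀ x → p x ≡ q x) → any p xs ≡ any q xs
  any-cong p q []       eq = refl
  any-cong p q (x ∷ xs) eq = cong₂ _∨_ (eq x) (any-cong p q xs eq)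

  all-intro : {A : Set} (p : A → Bool) (xs : List A) → (∀ x → x ∈ xs → p x ≡ true) → all p xs ≡ true
  all-intro p []       h = refl
  all-intro p (y ∷ xs) h rewrite h y (here refl) = all-intro p xs (λ x x∈ → h x (there x∈))

  all-elim : {A : Set} (p : A → Bool) (xs : List A) → all p xs ≡ true → ∀ x → x ∈ xs → p x ≡ true
  all-elim p (y ∷ xs) h x (here refl) = ∧-trueˡ h
  all-elim p (y ∷ xs) h x (there x∈) = all-elim p xs (∧-trueʳ {p y} h) x x∈

module Sums where

  open Booleans
  open import Data.Nat using (zero; suc; _+_; _*_; _<_; z≤n; s≤s; _≡ᵇ_)
  open import Data.Nat.Properties
  open import Data.Nat.Tactic.RingSolver using (solve-∀)
  open import Data.Bool using (true; false)
  open import Data.List using (List; []; _∷_; concatMap; map; _++_; concat; upTo; applyUpTo)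
  open import Data.Vec as Vec using ([]; _∷_)
  open import Data.Fin.Subset using (Subset; ∣_∣)

  ΣL : {A : Set} → List A → (A → ℕ) → ℕ
  ΣL []       g = 0
  ΣL (x ∷ xs) g = g x + ΣL xs g

  countᵇ-as-ΣL : {A : Set} (p : A → Bool) (xs : List A) → countᵇ p xs ≡ ΣL xs (λ x → 𝟙 (p x))
  countᵇ-as-ΣL p []       = refl
  countᵇ-as-ΣL p (x ∷ xs) = cong (𝟙 (p x) +_) (countᵇ-as-ΣL p xs)

  ΣL-cong : {A : Set} (xs : List A) {f g : A → ℕ} → (∀ x → f x ≡ g x) → ΣL xs f ≡ ΣL xs g
  ΣL-cong []       eq = refl
  ΣL-cong (x ∷ xs) eq = cong₂ _+_ (eq x) (ΣL-cong xs eq)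

  ΣL-zero : {A : Set} (xs : List A) {f : A → ℕ} → (∀ x → f x ≡ 0) → ΣL xs f ≡ 0
  ΣL-zero []       eq = refl
  ΣL-zero (x ∷ xs) eq = cong₂ _+_ (eq x) (ΣL-zero xs eq)

  ΣL-+ : {A : Set} (xs : List A) (f g : A → ℕ) → ΣL xs (λ x → f x + g x) ≡ ΣL xs f + ΣL xs g
  ΣL-+ []       f g = refl
  ΣL-+ (x ∷ xs) f g = trans (cong (f x + g x +_) (ΣL-+ xs f g)) (interchange (f x) (g x) _ _)
    where
    interchange : ∀ a b c d → a + b + (c + d) ≡ a + c + (b + d)
    interchange = solve-∀

  ΣL-*ˡ : {A : Set} (xs : List A) (k : ℕ) (f : A → ℕ) → ΣL xs (λ x → k * f x) ≡ k * ΣL xs f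
  ΣL-*ˡ []       k f = sym (*-zeroʳ k)
  ΣL-*ˡ (x ∷ xs) k f = trans (cong (k * f x +_) (ΣL-*ˡ xs k f)) (sym (*-distribˡ-+ k (f x) (ΣL xs f)))

  ΣL-*ʳ : {A : Set} (xs : List A) (k : ℕ) (f : A → ℕ) → ΣL xs (λ x → f x * k) ≡ ΣL xs f * k
  ΣL-*ʳ xs k f = trans (ΣL-cong xs (λ x → *-comm (f x) k)) (trans (ΣL-*ˡ xs k f) (*-comm k _))

  ΣL-++ : {A : Set} (xs ys : List A) (f : A → ℕ) → ΣL (xs ++ ys) f ≡ ΣL xs f + ΣL ys f
  ΣL-++ []       ys f = refl
  ΣL-++ (x ∷ xs) ys f = trans (cong (f x +_) (ΣL-++ xs ys f)) (sym (+-assoc (f x) _ _))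

  ΣL-concat : {A : Set} (xss : List (List A)) (f : A → ℕ) → ΣL (concat xss) f ≡ ΣL xss (λ xs → ΣL xs f)
  ΣL-concat []         f = refl
  ΣL-concat (xs ∷ xss) f = trans (ΣL-++ xs (concat xss) f) (cong (ΣL xs f +_) (ΣL-concat xss f))

  ΣL-map : {A B : Set} (h : A → B) (xs : List A) (f : B → ℕ) → ΣL (map h xs) f ≡ ΣL xs (λ x → f (h x))
  ΣL-map h []       f = refl
  ΣL-map h (x ∷ xs) f = cong (f (h x) +_) (ΣL-map h xs f)

  ΣL-concatMap : {A B : Set} (h : A → List B) (xs : List A) (f : B → ℕ) →
                 ΣL (concatMap h xs) f ≡ ΣL xs (λ x → ΣL (h x) f)
  ΣL-concatMap h xs f = trans (ΣL-concat (map h xs) f) (ΣL-map h xs (λ ys → ΣL ys f))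

  ΣL-swap : {A B : Set} (xs : List A) (ys : List B) (f : A → B → ℕ) →
            ΣL xs (λ x → ΣL ys (f x)) ≡ ΣL ys (λ y → ΣL xs (λ x → f x y))
  ΣL-swap []       ys f = sym (ΣL-zero ys (λ _ → refl))
  ΣL-swap (x ∷ xs) ys f =
    trans (cong (ΣL ys (f x) +_) (ΣL-swap xs ys f)) (sym (ΣL-+ ys (f x) (λ y → ΣL xs (λ x' → f x' y))))

  ΣS : (N : ℕ) → (Subset N → ℕ) → ℕ
  ΣS N g = ΣL (allSubsets N) g

  ΣS-cong : (N : ℕ) {f g : Subset N → ℕ} → (∀ s → f s ≡ g s) → ΣS N f ≡ ΣS N g
  ΣS-cong N = ΣL-cong (allSubsets N)

  ΣS-suc : (N : ℕ) (g : Subset (suc N) → ℕ) → ΣS (suc N) g ≡ ΣS N (λ s → g (false ∷ s) + g (true ∷ s))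
  ΣS-suc N g = trans (ΣL-concatMap _ (allSubsets N) g)
                     (ΣS-cong N (λ s → cong (g (false ∷ s) +_) (+-identityʳ _)))

  ΣS-++ : (m k : ℕ) (g : Subset (m + k) → ℕ) → ΣS (m + k) g ≡ ΣS m (λ v → ΣS k (λ w → g (v Vec.++ w)))
  ΣS-++ zero    k g = sym (+-identityʳ _)
  ΣS-++ (suc m) k g = begin
      ΣS (suc m + k) g
    ≡⟨ ΣS-suc (m + k) g ⟩
      ΣS (m + k) (λ s → g (false ∷ s) + g (true ∷ s))
    ≡⟨ ΣS-++ m k _ ⟩
      ΣS m (λ v → ΣS k (λ w → g (false ∷ (v Vec.++ w)) + g (true ∷ (v Vec.++ w))))
    ≡⟨ ΣS-cong m (λ v → ΣL-+ (allSubsets k) _ _) ⟩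
      ΣS m (λ v → ΣS k (λ w → g (false ∷ (v Vec.++ w))) + ΣS k (λ w → g (true ∷ (v Vec.++ w))))
    ≡⟨ sym (ΣS-suc m _) ⟩
      ΣS (suc m) (λ v → ΣS k (λ w → g (v Vec.++ w)))
    ∎
    where open ≡-Reasoning

  size-++ : ∀ {m k} (v : Subset m) (w : Subset k) → ∣ v Vec.++ w ∣ ≡ ∣ v ∣ + ∣ w ∣
  size-++ []          w = refl
  size-++ (true ∷ v)  w = cong suc (size-++ v w)
  size-++ (false ∷ v) w = size-++ v w

  bySize : ℕ → (ℕ → ℕ) → ℕ
  bySize N h = ΣS N (λ τ → h ∣ τ ∣)

  bySize-cong : (N : ℕ) {f g : ℕ → ℕ} → (∀ t → f t ≡ g t) → bySize N f ≡ bySize N g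
  bySize-cong N eq = ΣS-cong N (λ τ → eq ∣ τ ∣)

  bySize-dim : {N N' : ℕ} (h : ℕ → ℕ) → N ≡ N' → bySize N h ≡ bySize N' h
  bySize-dim h refl = refl

  bySize-suc : ∀ N h → bySize (suc N) h ≡ bySize N h + bySize N (λ t → h (suc t))
  bySize-suc N h = trans (ΣS-suc N _) (ΣL-+ (allSubsets N) _ _)

  bySize-++ : (m k : ℕ) (h : ℕ → ℕ) → bySize (m + k) h ≡ bySize m (λ t₁ → bySize k (λ t₂ → h (t₁ + t₂)))
  bySize-++ m k h = trans (ΣS-++ m k _) (ΣS-cong m (λ v → ΣS-cong k (λ w → cong h (size-++ v w))))

  ΣL-applyUpTo : ∀ m (f g : ℕ → ℕ) → ΣL (applyUpTo f m) g ≡ ΣL (upTo m) (λ x → g (f x))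
  ΣL-applyUpTo zero    f g = refl
  ΣL-applyUpTo (suc m) f g = cong (g (f 0) +_)
    (trans (ΣL-applyUpTo m (λ x → f (suc x)) g) (sym (ΣL-applyUpTo m suc (λ x → g (f x)))))

  ΣupTo-suc : ∀ m (g : ℕ → ℕ) → ΣL (upTo (suc m)) g ≡ g 0 + ΣL (upTo m) (λ x → g (suc x))
  ΣupTo-suc m g = cong (g 0 +_) (ΣL-applyUpTo m suc g)

  ΣupTo-cong : ∀ m {f g : ℕ → ℕ} → (∀ x → x < m → f x ≡ g x) → ΣL (upTo m) f ≡ ΣL (upTo m) g
  ΣupTo-cong zero    eq = refl
  ΣupTo-cong (suc m) {f} {g} eq = begin
      ΣL (upTo (suc m)) f
    ≡⟨ ΣupTo-suc m f ⟩
      f 0 + ΣL (upTo m) (λ x → f (suc x))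
    ≡⟨ cong₂ _+_ (eq 0 (s≤s z≤n)) (ΣupTo-cong m (λ x lt → eq (suc x) (s≤s lt))) ⟩
      g 0 + ΣL (upTo m) (λ x → g (suc x))
    ≡⟨ sym (ΣupTo-suc m g) ⟩
      ΣL (upTo (suc m)) g
    ∎
    where open ≡-Reasoning

  ΣupTo-δ : ∀ m y (g : ℕ → ℕ) → y < m → ΣL (upTo m) (λ x → 𝟙 (x ≡ᵇ y) * g x) ≡ g y
  ΣupTo-δ (suc m) zero    g lt =
    trans (ΣupTo-suc m (λ x → 𝟙 (x ≡ᵇ 0) * g x))
          (trans (cong₂ _+_ (+-identityʳ (g 0)) (ΣL-zero (upTo m) (λ _ → refl))) (+-identityʳ (g 0)))
  ΣupTo-δ (suc m) (suc y) g (s≤s lt) =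
    trans (ΣupTo-suc m (λ x → 𝟙 (x ≡ᵇ suc y) * g x)) (ΣupTo-δ m y (λ x → g (suc x)) lt)

-- Binomial coefficients by Pascal's rule (so that they compute by pattern matching),
-- their agreement with the library's n C k, and the identities needed for h-vectors.
module Binomials where

  open Booleans
  open Sums
  open import Data.Nat using (zero; suc; _+_; _*_; _∸_; _≤_; _<_; z≤n; s≤s; _≡ᵇ_; _!; NonZero)
  open import Data.Nat.Properties
  open import Data.Nat.Combinatorics
    using (_C_; nCk≡nC[n∸k]; nCn≡1; nCk+nC[k+1]≡[n+1]C[k+1]; k![n∸k]!∣n!)
  open import Data.Nat.Combinatorics.Specification using (nCk≡n!/k![n-k]!; k>n⇒nCk≡0)
  open import Data.Nat.DivMod using (_/_; m/n*n≡m)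
  open import Data.Nat.Tactic.RingSolver using (solve-∀)

  bin : ℕ → ℕ → ℕ
  bin n       zero    = 1
  bin zero    (suc k) = 0
  bin (suc n) (suc k) = bin n k + bin n (suc k)

  C≡bin : ∀ n k → n C k ≡ bin n k
  C≡bin n       zero    = trans (nCk≡nC[n∸k] {0} {n} z≤n) (nCn≡1 n)
  C≡bin zero    (suc k) = k>n⇒nCk≡0 (s≤s (z≤n {k}))
  C≡bin (suc n) (suc k) =
    trans (sym (nCk+nC[k+1]≡[n+1]C[k+1] n k)) (cong₂ _+_ (C≡bin n k) (C≡bin n (suc k)))

  bin-< : ∀ n k → n < k → bin n k ≡ 0
  bin-< zero    (suc k) lt       = refl
  bin-< (suc n) (suc k) (s≤s lt) = cong₂ _+_ (bin-< n k lt) (bin-< n (suc k) (m≤n⇒m≤1+n lt))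

  bySize-δ : ∀ N j → bySize N (λ t → 𝟙 (t ≡ᵇ j)) ≡ bin N j
  bySize-δ zero    zero    = refl
  bySize-δ zero    (suc j) = refl
  bySize-δ (suc N) zero    =
    trans (bySize-suc N (λ t → 𝟙 (t ≡ᵇ 0))) (cong₂ _+_ (bySize-δ N zero) (ΣL-zero (allSubsets N) (λ _ → refl)))
  bySize-δ (suc N) (suc j) =
    trans (bySize-suc N (λ t → 𝟙 (t ≡ᵇ suc j))) (trans (cong₂ _+_ (bySize-δ N (suc j)) (bySize-δ N j)) (+-comm (bin N (suc j)) _))

  sbin : ℕ → ℕ → ℕ → ℕ
  sbin N zero    k       = bin N k
  sbin N (suc s) zero    = 0
  sbin N (suc s) (suc k) = sbin N s k

  bySize-sbin : ∀ N s k → bySize N (λ t → 𝟙 (s + t ≡ᵇ k)) ≡ sbin N s k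
  bySize-sbin N zero    k       = bySize-δ N k
  bySize-sbin N (suc s) zero    = ΣL-zero (allSubsets N) (λ _ → refl)
  bySize-sbin N (suc s) (suc k) = bySize-sbin N s k

  sbin-+ : ∀ N i t → sbin N i (i + t) ≡ bin N t
  sbin-+ N zero    t = refl
  sbin-+ N (suc i) t = sbin-+ N i t

  sbin-< : ∀ N i l → l < i → sbin N i l ≡ 0
  sbin-< N (suc i) zero    lt       = refl
  sbin-< N (suc i) (suc l) (s≤s lt) = sbin-< N i l lt

  bin-factorial : ∀ k e → bin (k + e) k * (k ! * e !) ≡ (k + e) !
  bin-factorial k e = begin
      bin (k + e) k * (k ! * e !)
    ≡⟨ cong₂ (λ z w → z * (k ! * w !)) (sym (C≡bin (k + e) k)) (sym (m+n∸m≡n k e)) ⟩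
      ((k + e) C k) * (k ! * (k + e ∸ k) !)
    ≡⟨ cong (_* (k ! * (k + e ∸ k) !)) (nCk≡n!/k![n-k]! (m≤m+n k e)) ⟩
      ((k + e) ! / (k ! * (k + e ∸ k) !)) {{k !* (k + e ∸ k) !≢0}} * (k ! * (k + e ∸ k) !)
    ≡⟨ m/n*n≡m {{k !* (k + e ∸ k) !≢0}} (k![n∸k]!∣n! (m≤m+n k e)) ⟩
      (k + e) !
    ∎
    where open ≡-Reasoning

  -- choosing a t-set and then a (K-t)-set from the rest of a D-set is choosing a
  -- K-set and then a t-subset of it:  C(D,t) C(D-t,K-t) = C(D,K) C(K,t)
  bin-nested : ∀ t K D → t ≤ K → K ≤ D → bin (D ∸ t) (K ∸ t) * bin D t ≡ bin D K * bin K t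
  bin-nested t K D t≤K K≤D with K ∸ t | m+[n∸m]≡n t≤K | D ∸ K | m+[n∸m]≡n K≤D
  ... | b | refl | e | refl =
    trans (cong (λ x → bin x b * bin (t + b + e) t) (trans (cong (_∸ t) (+-assoc t b e)) (m+n∸m≡n t (b + e))))
          (*-cancelʳ-≡ _ _ (t ! * (b ! * e !)) {{nonZero}} factorials)
    where
    open ≡-Reasoning
    nonZero : NonZero (t ! * (b ! * e !))
    nonZero = m*n≢0 (t !) (b ! * e !) {{t !≢0}} {{m*n≢0 (b !) (e !) {{b !≢0}} {{e !≢0}}}}
    regroup₁ : ∀ p q x y z → p * q * (x * (y * z)) ≡ q * x * (p * (y * z))
    regroup₁ = solve-∀
    regroup₂ : ∀ p q x y z → p * q * (x * (y * z)) ≡ p * (q * (x * y) * z)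
    regroup₂ = solve-∀
    factorials : bin (b + e) b * bin (t + b + e) t * (t ! * (b ! * e !))
               ≡ bin (t + b + e) (t + b) * bin (t + b) t * (t ! * (b ! * e !))
    factorials = begin
        bin (b + e) b * bin (t + b + e) t * (t ! * (b ! * e !))
      ≡⟨ regroup₁ (bin (b + e) b) (bin (t + b + e) t) (t !) (b !) (e !) ⟩
        bin (t + b + e) t * t ! * (bin (b + e) b * (b ! * e !))
      ≡⟨ cong (bin (t + b + e) t * t ! *_) (bin-factorial b e) ⟩
        bin (t + b + e) t * t ! * (b + e) !
      ≡⟨ *-assoc (bin (t + b + e) t) (t !) _ ⟩
        bin (t + b + e) t * (t ! * (b + e) !)
      ≡⟨ cong (λ z → bin z t * (t ! * (b + e) !)) (+-assoc t b e) ⟩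
        bin (t + (b + e)) t * (t ! * (b + e) !)
      ≡⟨ bin-factorial t (b + e) ⟩
        (t + (b + e)) !
      ≡⟨ cong _! (sym (+-assoc t b e)) ⟩
        (t + b + e) !
      ≡⟨ sym (bin-factorial (t + b) e) ⟩
        bin (t + b + e) (t + b) * ((t + b) ! * e !)
      ≡⟨ cong (λ z → bin (t + b + e) (t + b) * (z * e !)) (sym (bin-factorial t b)) ⟩
        bin (t + b + e) (t + b) * (bin (t + b) t * (t ! * b !) * e !)
      ≡⟨ sym (regroup₂ (bin (t + b + e) (t + b)) (bin (t + b) t) (t !) (b !) (e !)) ⟩
        bin (t + b + e) (t + b) * bin (t + b) t * (t ! * (b ! * e !))
      ∎

module HVectors where

  open Booleans
  open Sums using (ΣL)
  open Binomials
  open import Data.Nat as ℕ using (zero; suc; _∸_; _≤_; _<_; z≤n; s≤s; _≡ᵇ_)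
  import Data.Nat.Properties as ℕP
  open import Data.Nat.Combinatorics using (_C_)
  open import Data.Integer as ℤ using (ℤ; +_; -_; _+_; _*_; _-_)
  open import Data.Integer.Properties
  open import Data.Integer.Tactic.RingSolver using (solve-∀)
  open import Data.List using (List; []; _∷_)
  open import Data.List.Membership.Propositional using (_∈_)
  open import Data.List.Relation.Unary.Any using (here; there)
  open import Data.Sum using (inj₁; inj₂)

  ΣZ : {A : Set} → List A → (A → ℤ) → ℤ
  ΣZ []       g = + 0
  ΣZ (x ∷ xs) g = g x + ΣZ xs g

  ΣZ-cong∈ : {A : Set} (xs : List A) {f g : A → ℤ} → (∀ x → x ∈ xs → f x ≡ g x) → ΣZ xs f ≡ ΣZ xs g
  ΣZ-cong∈ []       eq = refl
  ΣZ-cong∈ (x ∷ xs) eq = cong₂ _+_ (eq x (here refl)) (ΣZ-cong∈ xs (λ y y∈ → eq y (there y∈)))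

  ΣZ-pos : {A : Set} (xs : List A) (f : A → ℕ) → + ΣL xs f ≡ ΣZ xs (λ x → + f x)
  ΣZ-pos []       f = refl
  ΣZ-pos (x ∷ xs) f = trans (pos-+ (f x) (ΣL xs f)) (cong (λ w → + f x + w) (ΣZ-pos xs f))

  interchange : ∀ a b c d → a + b + (c + d) ≡ a + c + (b + d)
  interchange = solve-∀

  sumTo-cong≤ : ∀ k {f g : ℕ → ℤ} → (∀ l → l ≤ k → f l ≡ g l) → sumTo k f ≡ sumTo k g
  sumTo-cong≤ zero    eq = eq 0 z≤n
  sumTo-cong≤ (suc k) eq = cong₂ _+_ (sumTo-cong≤ k (λ l l≤ → eq l (ℕP.m≤n⇒m≤1+n l≤))) (eq (suc k) ℕP.≤-refl)

  sumTo-+ : ∀ k (f g : ℕ → ℤ) → sumTo k (λ l → f l + g l) ≡ sumTo k f + sumTo k g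
  sumTo-+ zero    f g = refl
  sumTo-+ (suc k) f g = trans (cong (_+ (f (suc k) + g (suc k))) (sumTo-+ k f g)) (interchange (sumTo k f) (sumTo k g) (f (suc k)) (g (suc k)))

  sumTo-- : ∀ k (f g : ℕ → ℤ) → sumTo k (λ l → f l - g l) ≡ sumTo k f - sumTo k g
  sumTo-- zero    f g = refl
  sumTo-- (suc k) f g = trans (cong (_+ (f (suc k) - g (suc k))) (sumTo-- k f g)) (regroup (sumTo k f) (sumTo k g) (f (suc k)) (g (suc k)))
    where
    regroup : ∀ a b c d → a - b + (c - d) ≡ a + c - (b + d)
    regroup = solve-∀

  sumTo-*ˡ : ∀ k (z : ℤ) (f : ℕ → ℤ) → sumTo k (λ l → z * f l) ≡ z * sumTo k f
  sumTo-*ˡ zero    z f = refl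
  sumTo-*ˡ (suc k) z f =
    trans (cong (_+ z * f (suc k)) (sumTo-*ˡ k z f)) (sym (*-distribˡ-+ z (sumTo k f) (f (suc k))))

  sumTo-zero : ∀ k (f : ℕ → ℤ) → (∀ l → l ≤ k → f l ≡ + 0) → sumTo k f ≡ + 0
  sumTo-zero k f eq = trans (sumTo-cong≤ k eq) (zeros k)
    where
    zeros : ∀ k → sumTo k (λ _ → + 0) ≡ + 0
    zeros zero    = refl
    zeros (suc k) = cong (_+ + 0) (zeros k)

  sumTo-first : ∀ k (f : ℕ → ℤ) → sumTo (suc k) f ≡ f 0 + sumTo k (λ t → f (suc t))
  sumTo-first zero    f = refl
  sumTo-first (suc k) f = trans (cong (_+ f (suc (suc k))) (sumTo-first k f)) (+-assoc (f 0) _ _)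

  sumTo-shift : ∀ i K (f : ℕ → ℤ) → (∀ l → l < i → f l ≡ + 0) → sumTo (i ℕ.+ K) f ≡ sumTo K (λ t → f (i ℕ.+ t))
  sumTo-shift i zero f z =
    trans (cong (λ m → sumTo m f) (ℕP.+-identityʳ i)) (trans (onlyLast i z) (cong f (sym (ℕP.+-identityʳ i))))
    where
    onlyLast : ∀ i → (∀ l → l < i → f l ≡ + 0) → sumTo i f ≡ f i
    onlyLast zero    z = refl
    onlyLast (suc i) z = trans (cong (_+ f (suc i)) (sumTo-zero i f (λ l l≤ → z l (s≤s l≤)))) (+-identityˡ _)
  sumTo-shift i (suc K) f z = begin
      sumTo (i ℕ.+ suc K) f
    ≡⟨ cong (λ m → sumTo m f) (ℕP.+-suc i K) ⟩
      sumTo (i ℕ.+ K) f + f (suc (i ℕ.+ K))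
    ≡⟨ cong₂ _+_ (sumTo-shift i K f z) (cong f (sym (ℕP.+-suc i K))) ⟩
      sumTo (suc K) (λ t → f (i ℕ.+ t))
    ∎
    where open ≡-Reasoning

  alternating-bin : ∀ K → sumTo K (λ t → sign (K ∸ t) * + bin K t) ≡ + 𝟙 (K ≡ᵇ 0)
  alternating-bin zero    = refl
  alternating-bin (suc K) = begin
      A (suc K)
    ≡⟨ sumTo-first K _ ⟩
      sign (suc K) * + 1 + sumTo K (λ u → sign (K ∸ u) * + (bin K u ℕ.+ bin K (suc u)))
    ≡⟨ cong (λ w → sign (suc K) * + 1 + w) (trans (sumTo-cong≤ K (λ u _ → pascal u)) (sumTo-+ K _ _)) ⟩
      sign (suc K) * + 1 + (A K + A⁺ K)
    ≡⟨ cong (λ w → sign (suc K) * + 1 + (A K + w)) (A⁺≡ K) ⟩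
      sign (suc K) * + 1 + (A K + (- A K + sign K))
    ≡⟨ cancel (sign K) (A K) ⟩
      + 0
    ∎
    where
    open ≡-Reasoning
    A A⁺ : ℕ → ℤ
    A  K = sumTo K (λ t → sign (K ∸ t) * + bin K t)
    A⁺ K = sumTo K (λ u → sign (K ∸ u) * + bin K (suc u))
    pascal : ∀ u → sign (K ∸ u) * + (bin K u ℕ.+ bin K (suc u))
                 ≡ sign (K ∸ u) * + bin K u + sign (K ∸ u) * + bin K (suc u)
    pascal u = trans (cong (sign (K ∸ u) *_) (pos-+ (bin K u) _)) (*-distribˡ-+ (sign (K ∸ u)) _ _)
    cancel : ∀ s a → - s * + 1 + (a + (- a + s)) ≡ + 0
    cancel = solve-∀
    -- the sum with shifted binomials differs from - A K by the missing first term
    A⁺≡ : ∀ K → A⁺ K ≡ - A K + sign K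
    A⁺≡ zero    = refl
    A⁺≡ (suc K) = begin
        A⁺ (suc K)
      ≡⟨ cong₂ _+_ (sumTo-cong≤ K (λ u u≤ → flip u u≤))
                   (cong₂ (λ a m → sign a * + m) (ℕP.n∸n≡0 K) (bin-< (suc K) (suc (suc K)) ℕP.≤-refl)) ⟩
        sumTo K (λ u → - + 1 * (sign (K ∸ u) * + bin (suc K) (suc u))) + sign 0 * + 0
      ≡⟨ cong (_+ sign 0 * + 0) (sumTo-*ˡ K (- + 1) _) ⟩
        - + 1 * R + sign 0 * + 0
      ≡⟨ regroup R (sign (suc K)) ⟩
        - (sign (suc K) * + 1 + R) + sign (suc K)
      ≡⟨ cong (λ w → - w + sign (suc K)) (sym (sumTo-first K (λ t → sign (suc K ∸ t) * + bin (suc K) t))) ⟩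
        - A (suc K) + sign (suc K)
      ∎
      where
      R : ℤ
      R = sumTo K (λ u → sign (K ∸ u) * + bin (suc K) (suc u))
      flip : ∀ u → u ≤ K → sign (suc K ∸ u) * + bin (suc K) (suc u) ≡ - + 1 * (sign (K ∸ u) * + bin (suc K) (suc u))
      flip u u≤ = trans (cong (λ m → sign m * + bin (suc K) (suc u)) (ℕP.+-∸-assoc 1 u≤)) (negate (sign (K ∸ u)) _)
        where
        negate : ∀ s x → - s * x ≡ - + 1 * (s * x)
        negate = solve-∀
      regroup : ∀ r s → - + 1 * r + + 1 * + 0 ≡ - (s * + 1 + r) + s
      regroup = solve-∀

  hVec-cong : ∀ d k {f g : ℕ → ℕ} → (∀ l → f l ≡ g l) → hVec d f k ≡ hVec d g k
  hVec-cong d k eq = sumTo-cong≤ k (λ l _ → cong (λ z → sign (k ∸ l) * + (((d ∸ l) C (k ∸ l)) ℕ.* z)) (eq l))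

  hVec-zero : ∀ d k → hVec d (λ _ → 0) k ≡ + 0
  hVec-zero d k = sumTo-zero k _ (λ l _ →
    trans (cong (λ m → sign (k ∸ l) * + m) (ℕP.*-zeroʳ ((d ∸ l) C (k ∸ l)))) (*-zeroʳ (sign (k ∸ l))))

  hVec-+ : ∀ d k (f g : ℕ → ℕ) → hVec d (λ l → f l ℕ.+ g l) k ≡ hVec d f k + hVec d g k
  hVec-+ d k f g = trans (sumTo-cong≤ k (λ l _ → term l)) (sumTo-+ k _ _)
    where
    term : ∀ l → sign (k ∸ l) * + (((d ∸ l) C (k ∸ l)) ℕ.* (f l ℕ.+ g l))
               ≡ sign (k ∸ l) * + (((d ∸ l) C (k ∸ l)) ℕ.* f l) + sign (k ∸ l) * + (((d ∸ l) C (k ∸ l)) ℕ.* g l)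
    term l = trans (cong (λ z → sign (k ∸ l) * + z) (ℕP.*-distribˡ-+ ((d ∸ l) C (k ∸ l)) (f l) (g l)))
                   (trans (cong (sign (k ∸ l) *_) (pos-+ (((d ∸ l) C (k ∸ l)) ℕ.* f l) _)) (*-distribˡ-+ (sign (k ∸ l)) _ _))

  hVec-*ˡ : ∀ d k y (f : ℕ → ℕ) → hVec d (λ l → y ℕ.* f l) k ≡ + y * hVec d f k
  hVec-*ˡ d k y f = trans (sumTo-cong≤ k (λ l _ → term l)) (sumTo-*ˡ k (+ y) _)
    where
    swap : ∀ s b y f → s * (b * (y * f)) ≡ y * (s * (b * f))
    swap = solve-∀
    term : ∀ l → sign (k ∸ l) * + (((d ∸ l) C (k ∸ l)) ℕ.* (y ℕ.* f l))
               ≡ + y * (sign (k ∸ l) * + (((d ∸ l) C (k ∸ l)) ℕ.* f l))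
    term l = begin
        sign (k ∸ l) * + (B ℕ.* (y ℕ.* f l))
      ≡⟨ cong (sign (k ∸ l) *_) (trans (pos-* B _) (cong (+ B *_) (pos-* y (f l)))) ⟩
        sign (k ∸ l) * (+ B * (+ y * + f l))
      ≡⟨ swap (sign (k ∸ l)) (+ B) (+ y) (+ f l) ⟩
        + y * (sign (k ∸ l) * (+ B * + f l))
      ≡⟨ cong (λ w → + y * (sign (k ∸ l) * w)) (sym (pos-* B (f l))) ⟩
        + y * (sign (k ∸ l) * + (B ℕ.* f l))
      ∎
      where
      open ≡-Reasoning
      B : ℕ
      B = (d ∸ l) C (k ∸ l)

  hVec-ΣL : ∀ d k {A : Set} (L : List A) (F : A → ℕ → ℕ) →
            hVec d (λ l → ΣL L (λ x → F x l)) k ≡ ΣZ L (λ x → hVec d (F x) k)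
  hVec-ΣL d k []      F = hVec-zero d k
  hVec-ΣL d k (x ∷ L) F =
    trans (hVec-+ d k (F x) (λ l → ΣL L (λ x' → F x' l))) (cong (λ w → hVec d (F x) k + w) (hVec-ΣL d k L F))

  hTerm-sbin-< : ∀ d i k l → l < i → sign (k ∸ l) * + (((d ∸ l) C (k ∸ l)) ℕ.* sbin (d ∸ i) i l) ≡ + 0
  hTerm-sbin-< d i k l l<i =
    trans (cong (λ m → sign (k ∸ l) * + (((d ∸ l) C (k ∸ l)) ℕ.* m)) (sbin-< (d ∸ i) i l l<i))
          (trans (cong (λ m → sign (k ∸ l) * + m) (ℕP.*-zeroʳ ((d ∸ l) C (k ∸ l)))) (*-zeroʳ (sign (k ∸ l))))

  -- h_{i+K} of l ↦ C(d-i, l-i) is C(d-i,K) Σ_t (-1)^{K-t} C(K,t), which is [K = 0]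
  hVec-sbin-above : ∀ d i K → i ℕ.+ K ≤ d → hVec d (sbin (d ∸ i) i) (i ℕ.+ K) ≡ + 𝟙 (i ≡ᵇ i ℕ.+ K)
  hVec-sbin-above d i K i+K≤d = begin
      hVec d (sbin D i) (i ℕ.+ K)
    ≡⟨ sumTo-shift i K _ (hTerm-sbin-< d i (i ℕ.+ K)) ⟩
      sumTo K (λ t → sign (i ℕ.+ K ∸ (i ℕ.+ t))
                     * + (((d ∸ (i ℕ.+ t)) C (i ℕ.+ K ∸ (i ℕ.+ t))) ℕ.* sbin D i (i ℕ.+ t)))
    ≡⟨ sumTo-cong≤ K term ⟩
      sumTo K (λ t → + bin D K * (sign (K ∸ t) * + bin K t))
    ≡⟨ sumTo-*ˡ K (+ bin D K) _ ⟩
      + bin D K * sumTo K (λ t → sign (K ∸ t) * + bin K t)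
    ≡⟨ cong (+ bin D K *_) (alternating-bin K) ⟩
      + bin D K * + 𝟙 (K ≡ᵇ 0)
    ≡⟨ onlyZero K ⟩
      + 𝟙 (i ≡ᵇ i ℕ.+ K)
    ∎
    where
    open ≡-Reasoning
    D : ℕ
    D = d ∸ i
    K≤D : K ≤ D
    K≤D = subst (_≤ D) (ℕP.m+n∸m≡n i K) (ℕP.∸-monoˡ-≤ i i+K≤d)
    swap : ∀ s x y → s * (x * y) ≡ x * (s * y)
    swap = solve-∀
    term : ∀ t → t ≤ K →
           sign (i ℕ.+ K ∸ (i ℕ.+ t)) * + (((d ∸ (i ℕ.+ t)) C (i ℕ.+ K ∸ (i ℕ.+ t))) ℕ.* sbin D i (i ℕ.+ t))
                       ≡ + bin D K * (sign (K ∸ t) * + bin K t)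
    term t t≤K = begin
        sign (i ℕ.+ K ∸ (i ℕ.+ t)) * + (((d ∸ (i ℕ.+ t)) C (i ℕ.+ K ∸ (i ℕ.+ t))) ℕ.* sbin D i (i ℕ.+ t))
      ≡⟨ cong₂ (λ a b → sign a * + ((b C a) ℕ.* sbin D i (i ℕ.+ t)))
               (ℕP.[m+n]∸[m+o]≡n∸o i K t) (sym (ℕP.∸-+-assoc d i t)) ⟩
        sign (K ∸ t) * + (((D ∸ t) C (K ∸ t)) ℕ.* sbin D i (i ℕ.+ t))
      ≡⟨ cong₂ (λ x y → sign (K ∸ t) * + (x ℕ.* y)) (C≡bin (D ∸ t) (K ∸ t)) (sbin-+ D i t) ⟩
        sign (K ∸ t) * + (bin (D ∸ t) (K ∸ t) ℕ.* bin D t)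
      ≡⟨ cong (λ m → sign (K ∸ t) * + m) (bin-nested t K D t≤K K≤D) ⟩
        sign (K ∸ t) * + (bin D K ℕ.* bin K t)
      ≡⟨ cong (sign (K ∸ t) *_) (pos-* (bin D K) (bin K t)) ⟩
        sign (K ∸ t) * (+ bin D K * + bin K t)
      ≡⟨ swap (sign (K ∸ t)) (+ bin D K) (+ bin K t) ⟩
        + bin D K * (sign (K ∸ t) * + bin K t)
      ∎
    onlyZero : ∀ K → + bin D K * + 𝟙 (K ≡ᵇ 0) ≡ + 𝟙 (i ≡ᵇ i ℕ.+ K)
    onlyZero zero    = cong (λ b → + 𝟙 b) (sym (≡⇒≡ᵇ-true i (i ℕ.+ 0) (sym (ℕP.+-identityʳ i))))
    onlyZero (suc K) = trans (*-zeroʳ (+ bin D (suc K)))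
      (cong (λ b → + 𝟙 b) (sym (≢⇒≡ᵇ-false i (i ℕ.+ suc K) (λ e → ℕP.m≢1+m+n i (trans e (ℕP.+-suc i K))))))

  hVec-sbin : ∀ d i k → k ≤ d → hVec d (sbin (d ∸ i) i) k ≡ + 𝟙 (i ≡ᵇ k)
  hVec-sbin d i k k≤d with ℕP.<-≤-connex k i
  ... | inj₁ k<i =
    trans (sumTo-zero k _ (λ l l≤k → hTerm-sbin-< d i k l (ℕP.≤-<-trans l≤k k<i)))
          (cong (λ b → + 𝟙 b) (sym (≢⇒≡ᵇ-false i k (λ e → ℕP.<-irrefl (sym e) k<i))))
  ... | inj₂ i≤k with k ∸ i | ℕP.m+[n∸m]≡n i≤k
  ... | K | refl = hVec-sbin-above d i K k≤d

  hVec-sbin-mixture : ∀ D k (L : List ℕ) (y s : ℕ → ℕ) → (∀ i → i ∈ L → s i ≤ D) → k ≤ D →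
    hVec D (λ l → ΣL L (λ i → y i ℕ.* sbin (D ∸ s i) (s i) l)) k ≡ + ΣL L (λ i → y i ℕ.* 𝟙 (s i ≡ᵇ k))
  hVec-sbin-mixture D k L y s s≤D k≤D = begin
      hVec D (λ l → ΣL L (λ i → y i ℕ.* sbin (D ∸ s i) (s i) l)) k
    ≡⟨ hVec-ΣL D k L (λ i l → y i ℕ.* sbin (D ∸ s i) (s i) l) ⟩
      ΣZ L (λ i → hVec D (λ l → y i ℕ.* sbin (D ∸ s i) (s i) l) k)
    ≡⟨ ΣZ-cong∈ L (λ i _ → hVec-*ˡ D k (y i) _) ⟩
      ΣZ L (λ i → + y i * hVec D (sbin (D ∸ s i) (s i)) k)
    ≡⟨ ΣZ-cong∈ L (λ i _ → cong (+ y i *_) (hVec-sbin D (s i) k k≤D)) ⟩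
      ΣZ L (λ i → + y i * + 𝟙 (s i ≡ᵇ k))
    ≡⟨ ΣZ-cong∈ L (λ i _ → sym (pos-* (y i) _)) ⟩
      ΣZ L (λ i → + (y i ℕ.* 𝟙 (s i ≡ᵇ k)))
    ≡⟨ sym (ΣZ-pos L _) ⟩
      + ΣL L (λ i → y i ℕ.* 𝟙 (s i ≡ᵇ k))
    ∎
    where open ≡-Reasoning

  -- g-vectors are h-vectors one dimension up: h_{k+1}(d) - h_k(d) = h_{k+1}(d+1),
  -- termwise by Pascal's rule
  g≡h-suc : ∀ d k F → suc k ≤ d → gVec d F (suc k) ≡ hVec (suc d) F (suc k)
  g≡h-suc d k F sk≤d = sym (begin
      hVec (suc d) F (suc k)
    ≡⟨⟩
      sumTo k (λ l → sign (suc k ∸ l) * + (((suc d ∸ l) C (suc k ∸ l)) ℕ.* F l)) + last (suc d)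
    ≡⟨ cong₂ _+_ (sumTo-cong≤ k pascal) (trans (last≡ (suc d)) (sym (last≡ d))) ⟩
      sumTo k (λ l → X l - Y l) + last d
    ≡⟨ cong (_+ last d) (sumTo-- k X Y) ⟩
      sumTo k X - sumTo k Y + last d
    ≡⟨ regroup (sumTo k X) (sumTo k Y) (last d) ⟩
      sumTo k X + last d - sumTo k Y
    ∎)
    where
    open ≡-Reasoning
    X Y : ℕ → ℤ
    X l = sign (suc k ∸ l) * + (((d ∸ l) C (suc k ∸ l)) ℕ.* F l)
    Y l = sign (k ∸ l) * + (((d ∸ l) C (k ∸ l)) ℕ.* F l)
    last : ℕ → ℤ
    last e = sign (suc k ∸ suc k) * + (((e ∸ suc k) C (suc k ∸ suc k)) ℕ.* F (suc k))
    last≡ : ∀ e → last e ≡ + F (suc k)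
    last≡ e = trans (cong₂ (λ a b → sign a * + (b ℕ.* F (suc k))) (ℕP.n∸n≡0 k)
                           (trans (cong ((e ∸ suc k) C_) (ℕP.n∸n≡0 k)) (C≡bin (e ∸ suc k) 0)))
                    (trans (*-identityˡ _) (cong +_ (ℕP.+-identityʳ _)))
    regroup : ∀ a b c → a - b + c ≡ a + c - b
    regroup = solve-∀
    split : ∀ s b₁ b₂ f → - s * ((b₁ + b₂) * f) ≡ - s * (b₂ * f) - s * (b₁ * f)
    split = solve-∀
    pascal : ∀ l → l ≤ k → sign (suc k ∸ l) * + (((suc d ∸ l) C (suc k ∸ l)) ℕ.* F l) ≡ X l - Y l
    pascal l l≤k = begin
        sign (suc k ∸ l) * + (((suc d ∸ l) C (suc k ∸ l)) ℕ.* F l)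
      ≡⟨ cong₂ (λ a b → sign a * + ((b C a) ℕ.* F l)) (ℕP.+-∸-assoc 1 l≤k) (ℕP.+-∸-assoc 1 l≤d) ⟩
        - s * + ((suc (d ∸ l) C suc (k ∸ l)) ℕ.* F l)
      ≡⟨ cong (λ b → - s * + (b ℕ.* F l)) (C≡bin (suc (d ∸ l)) (suc (k ∸ l))) ⟩
        - s * + ((b₁ ℕ.+ b₂) ℕ.* F l)
      ≡⟨ cong (λ w → - s * w) (trans (pos-* (b₁ ℕ.+ b₂) (F l)) (cong (_* + F l) (pos-+ b₁ b₂))) ⟩
        - s * ((+ b₁ + + b₂) * + F l)
      ≡⟨ split s (+ b₁) (+ b₂) (+ F l) ⟩
        - s * (+ b₂ * + F l) - s * (+ b₁ * + F l)
      ≡⟨ cong₂ (λ u v → - s * u - s * v) (sym (pos-* b₂ (F l))) (sym (pos-* b₁ (F l))) ⟩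
        - s * + (b₂ ℕ.* F l) - s * + (b₁ ℕ.* F l)
      ≡⟨ cong₂ (λ u v → u - s * + (v ℕ.* F l)) X≡ (sym (C≡bin (d ∸ l) (k ∸ l))) ⟩
        X l - Y l
      ∎
      where
      l≤d : l ≤ d
      l≤d = ℕP.≤-trans l≤k (ℕP.≤-trans (ℕP.n≤1+n k) sk≤d)
      s : ℤ
      s  = sign (k ∸ l)
      b₁ b₂ : ℕ
      b₁ = bin (d ∸ l) (k ∸ l)
      b₂ = bin (d ∸ l) (suc (k ∸ l))
      X≡ : - s * + (b₂ ℕ.* F l) ≡ X l
      X≡ = cong₂ (λ a b → sign a * + (b ℕ.* F l)) (sym (ℕP.+-∸-assoc 1 l≤k))
                 (trans (sym (C≡bin (d ∸ l) (suc (k ∸ l)))) (cong ((d ∸ l) C_) (sym (ℕP.+-∸-assoc 1 l≤k))))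

module Subsets where

  open Booleans
  open Sums
  open import Data.Nat using (zero; suc; _+_)
  open import Data.Nat.Properties using (+-identityʳ)
  open import Data.Bool using (true; false; _∧_; _∨_; not)
  open import Data.Bool.Properties using (∧-assoc; ∧-comm; ∧-zeroʳ)
  open import Data.Vec using ([]; _∷_; _++_; take; drop)
  open import Data.Fin.Subset using (Subset; ∣_∣; ⊤)
  open import Data.List.Membership.Propositional using (_∈_; lose)
  open import Data.List.Membership.Propositional.Properties using (∈-concatMap⁺)
  open import Data.List.Relation.Unary.Any using (here; there)

  ⊆-⊤ : ∀ {m} (v : Subset m) → v ⊆ᵇ ⊤ ≡ true
  ⊆-⊤ []          = refl
  ⊆-⊤ (true ∷ v)  = ⊆-⊤ v
  ⊆-⊤ (false ∷ v) = ⊆-⊤ v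

  ⊆-refl : ∀ {m} (v : Subset m) → v ⊆ᵇ v ≡ true
  ⊆-refl []          = refl
  ⊆-refl (true ∷ v)  = ⊆-refl v
  ⊆-refl (false ∷ v) = ⊆-refl v

  ⊆-trans : ∀ {m} (u v w : Subset m) → u ⊆ᵇ v ≡ true → v ⊆ᵇ w ≡ true → u ⊆ᵇ w ≡ true
  ⊆-trans []          []          []          _  _ = refl
  ⊆-trans (false ∷ u) (true ∷ v)  (true ∷ w)  p q = ⊆-trans u v w p q
  ⊆-trans (false ∷ u) (false ∷ v) (z ∷ w)     p q = ⊆-trans u v w p q
  ⊆-trans (true ∷ u)  (true ∷ v)  (true ∷ w)  p q = ⊆-trans u v w p q

  =ᵇ-sym : ∀ {N} (s t : Subset N) → s =ᵇ t ≡ t =ᵇ s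
  =ᵇ-sym s t = ∧-comm (s ⊆ᵇ t) (t ⊆ᵇ s)

  =ᵇ-∷ : ∀ {N} x y (s t : Subset N) → ((x ∷ s) =ᵇ (y ∷ t)) ≡ ((not x ∨ y) ∧ (not y ∨ x)) ∧ (s =ᵇ t)
  =ᵇ-∷ true  true  s t = refl
  =ᵇ-∷ true  false s t = refl
  =ᵇ-∷ false true  s t = ∧-zeroʳ _
  =ᵇ-∷ false false s t = refl

  =ᵇ⇒≡ : ∀ {N} (s t : Subset N) → s =ᵇ t ≡ true → s ≡ t
  =ᵇ⇒≡ []      []      p = refl
  =ᵇ⇒≡ (x ∷ s) (y ∷ t) p rewrite =ᵇ-∷ x y s t =
    cong₂ _∷_ (head x y (∧-trueˡ p)) (=ᵇ⇒≡ s t (∧-trueʳ {(not x ∨ y) ∧ (not y ∨ x)} p))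
    where
    head : ∀ x y → (not x ∨ y) ∧ (not y ∨ x) ≡ true → x ≡ y
    head true  true  _ = refl
    head false false _ = refl

  ΣS-=ᵇ : ∀ N (t : Subset N) → ΣS N (λ s → 𝟙 (s =ᵇ t)) ≡ 1
  ΣS-=ᵇ zero    []      = refl
  ΣS-=ᵇ (suc N) (b ∷ t) =
    trans (ΣS-suc N _) (trans (ΣS-cong N (λ s → cong₂ _+_ (cong 𝟙 (=ᵇ-∷ false b s t)) (cong 𝟙 (=ᵇ-∷ true b s t))))
                              (byHead b))
    where
    byHead : ∀ b → ΣS N (λ s → 𝟙 (((not false ∨ b) ∧ (not b ∨ false)) ∧ (s =ᵇ t))
                             + 𝟙 (((not true ∨ b) ∧ (not b ∨ true)) ∧ (s =ᵇ t))) ≡ 1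
    byHead true  = ΣS-=ᵇ N t
    byHead false = trans (ΣS-cong N (λ s → +-identityʳ _)) (ΣS-=ᵇ N t)

  ∈allSubsets : ∀ N (s : Subset N) → s ∈ allSubsets N
  ∈allSubsets zero    []          = here refl
  ∈allSubsets (suc N) (false ∷ s) = ∈-concatMap⁺ _ (lose (∈allSubsets N s) (here refl))
  ∈allSubsets (suc N) (true ∷ s)  = ∈-concatMap⁺ _ (lose (∈allSubsets N s) (there (here refl)))

  take-++ : ∀ {A : Set} m {k} (v : Vec A m) (w : Vec A k) → take m (v ++ w) ≡ v
  take-++ zero    []      w = refl
  take-++ (suc m) (x ∷ v) w = cong (x ∷_) (take-++ m v w)

  drop-++ : ∀ {A : Set} m {k} (v : Vec A m) (w : Vec A k) → drop m (v ++ w) ≡ w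
  drop-++ zero    []      w = refl
  drop-++ (suc m) (x ∷ v) w = drop-++ m v w

  ⊆-++ : ∀ {m k} (v v' : Subset m) (w w' : Subset k) → (v ++ w) ⊆ᵇ (v' ++ w') ≡ (v ⊆ᵇ v') ∧ (w ⊆ᵇ w')
  ⊆-++ []      []       w w' = refl
  ⊆-++ (x ∷ v) (y ∷ v') w w' = trans (cong ((not x ∨ y) ∧_) (⊆-++ v v' w w')) (sym (∧-assoc (not x ∨ y) _ _))

  ⊆-split : ∀ m {k} (σ : Subset (m + k)) (X : Subset m) (Y : Subset k) →
            σ ⊆ᵇ (X ++ Y) ≡ (take m σ ⊆ᵇ X) ∧ (drop m σ ⊆ᵇ Y)
  ⊆-split zero    σ       []      Y = refl
  ⊆-split (suc m) (x ∷ σ) (y ∷ X) Y = trans (cong ((not x ∨ y) ∧_) (⊆-split m σ X Y)) (sym (∧-assoc (not x ∨ y) _ _))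

  size-take-drop : ∀ m {k} (σ : Subset (m + k)) → ∣ σ ∣ ≡ ∣ take m σ ∣ + ∣ drop m σ ∣
  size-take-drop zero    σ           = refl
  size-take-drop (suc m) (true ∷ σ)  = cong suc (size-take-drop m σ)
  size-take-drop (suc m) (false ∷ σ) = size-take-drop m σ

-- One block of vertices x_i^(0), …, x_i^(m-1) (m = c_i + 1), seen as Subset m.
-- The facet F_c(a) restricts to the block as omit m a_i; a face restricts to a
-- subset v, and the monomials a with v ⊆ omit m a_i are exactly the gaps of v.
-- firstGap v and lastGap v are the least and greatest of them (lastGap v = m when
-- v has no gap), which become the exponents of lo σ and hi σ.
module Blocks where

  open Booleans
  open Sums
  open Subsets
  open import Data.Nat using (zero; suc; _+_; _*_; _∸_; _≤_; _<_; z≤n; s≤s; _≡ᵇ_)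
  open import Data.Nat.Properties
  open import Data.Bool using (true; false; _∨_; not; if_then_else_)
  open import Data.List using (upTo)
  open import Data.Vec as Vec using ([]; _∷_)
  open import Data.Fin using (Fin; toℕ)
  open import Data.Fin.Subset using (Subset; ∣_∣; ⊤)
  open import Data.Fin.Subset.Properties using (∣⊤∣≡n)
  open import Relation.Nullary using (¬_)
  open import Data.Empty using (⊥-elim)

  omit : (m x : ℕ) → Subset m
  omit zero    x       = []
  omit (suc m) zero    = false ∷ ⊤
  omit (suc m) (suc x) = true ∷ omit m x

  omit₂ : (m x y : ℕ) → Subset m
  omit₂ zero    x       y       = []
  omit₂ (suc m) zero    zero    = false ∷ ⊤
  omit₂ (suc m) zero    (suc y) = false ∷ omit m y
  omit₂ (suc m) (suc x) zero    = false ∷ omit m x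
  omit₂ (suc m) (suc x) (suc y) = true ∷ omit₂ m x y

  tabulate-omit : ∀ m x → Vec.tabulate (λ (j : Fin m) → not (toℕ j ≡ᵇ x)) ≡ omit m x
  tabulate-omit zero    x       = refl
  tabulate-omit (suc m) zero    = cong (false ∷_) (tabulate-⊤ m)
    where
    tabulate-⊤ : ∀ m → Vec.tabulate (λ (_ : Fin m) → true) ≡ ⊤
    tabulate-⊤ zero    = refl
    tabulate-⊤ (suc m) = cong (true ∷_) (tabulate-⊤ m)
  tabulate-omit (suc m) (suc x) = cong (true ∷_) (tabulate-omit m x)

  -- the first gap of v (0 if v starts with a gap; m if v has no gap)
  firstGap : ∀ {m} → Subset m → ℕ
  firstGap []          = 0
  firstGap (false ∷ v) = 0
  firstGap (true ∷ v)  = suc (firstGap v)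

  hasGap : ∀ {m} → Subset m → Bool
  hasGap []      = false
  hasGap (b ∷ v) = not b ∨ hasGap v

  -- the last gap of v (m if v has no gap)
  lastGap : ∀ {m} → Subset m → ℕ
  lastGap []          = 0
  lastGap (true ∷ v)  = suc (lastGap v)
  lastGap (false ∷ v) = if hasGap v then suc (lastGap v) else 0

  gaps : ∀ {m} → Subset m → ℕ
  gaps []      = 0
  gaps (b ∷ v) = 𝟙 (not b) + gaps v

  size+gaps : ∀ {m} (v : Subset m) → ∣ v ∣ + gaps v ≡ m
  size+gaps []          = refl
  size+gaps (true ∷ v)  = cong suc (size+gaps v)
  size+gaps (false ∷ v) = trans (+-suc ∣ v ∣ (gaps v)) (cong suc (size+gaps v))

  hasGap-⊤ : ∀ m → hasGap (⊤ {m}) ≡ false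
  hasGap-⊤ zero    = refl
  hasGap-⊤ (suc m) = hasGap-⊤ m

  ⊆-omit⇒hasGap : ∀ {m} (v : Subset m) x → v ⊆ᵇ omit m x ≡ true → x < m → hasGap v ≡ true
  ⊆-omit⇒hasGap (false ∷ v) x       p lt       = refl
  ⊆-omit⇒hasGap (true ∷ v)  (suc x) p (s≤s lt) = ⊆-omit⇒hasGap v x p lt

  ⊆-omit-firstGap : ∀ {m} (v : Subset m) → v ⊆ᵇ omit m (firstGap v) ≡ true
  ⊆-omit-firstGap []          = refl
  ⊆-omit-firstGap (false ∷ v) = ⊆-⊤ v
  ⊆-omit-firstGap (true ∷ v)  = ⊆-omit-firstGap v

  firstGap-≤ : ∀ {m} (v : Subset m) x → v ⊆ᵇ omit m x ≡ true → x < m → firstGap v ≤ x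
  firstGap-≤ (false ∷ v) x       p lt       = z≤n
  firstGap-≤ (true ∷ v)  (suc x) p (s≤s lt) = s≤s (firstGap-≤ v x p lt)

  ⊆-omit-lastGap : ∀ {m} (v : Subset m) → v ⊆ᵇ omit m (lastGap v) ≡ true
  ⊆-omit-lastGap []          = refl
  ⊆-omit-lastGap (true ∷ v)  = ⊆-omit-lastGap v
  ⊆-omit-lastGap (false ∷ v) with hasGap v
  ... | true  = ⊆-omit-lastGap v
  ... | false = ⊆-⊤ v

  ≤-lastGap : ∀ {m} (v : Subset m) x → v ⊆ᵇ omit m x ≡ true → x < m → x ≤ lastGap v
  ≤-lastGap (b ∷ v)     zero    p lt       = z≤n
  ≤-lastGap (true ∷ v)  (suc x) p (s≤s lt) = s≤s (≤-lastGap v x p lt)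
  ≤-lastGap (false ∷ v) (suc x) p (s≤s lt) with hasGap v | ⊆-omit⇒hasGap v x p lt
  ... | true | _ = s≤s (≤-lastGap v x p lt)

  ¬hasGap⇒lastGap : ∀ {m} (v : Subset m) → hasGap v ≡ false → lastGap v ≡ m
  ¬hasGap⇒lastGap []         h = refl
  ¬hasGap⇒lastGap (true ∷ v) h = cong suc (¬hasGap⇒lastGap v h)

  firstGap<⇒lastGap< : ∀ {m} (v : Subset m) → firstGap v < m → lastGap v < m
  firstGap<⇒lastGap< v lt = hasGap⇒lastGap< v (firstGap<⇒hasGap v lt)
    where
    firstGap<⇒hasGap : ∀ {m} (v : Subset m) → firstGap v < m → hasGap v ≡ true
    firstGap<⇒hasGap (false ∷ v) lt       = refl
    firstGap<⇒hasGap (true ∷ v)  (s≤s lt) = firstGap<⇒hasGap v lt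
    hasGap⇒lastGap< : ∀ {m} (v : Subset m) → hasGap v ≡ true → lastGap v < m
    hasGap⇒lastGap< (true ∷ v)  h = s≤s (hasGap⇒lastGap< v h)
    hasGap⇒lastGap< (false ∷ v) h with hasGap v in eq
    ... | true  = s≤s (hasGap⇒lastGap< v eq)
    ... | false = s≤s z≤n

  firstGap-omit : ∀ m x → x < m → firstGap (omit m x) ≡ x
  firstGap-omit (suc m) zero    lt       = refl
  firstGap-omit (suc m) (suc x) (s≤s lt) = cong suc (firstGap-omit m x lt)

  lastGap-omit : ∀ m x → x < m → lastGap (omit m x) ≡ x
  lastGap-omit (suc m) zero    lt rewrite hasGap-⊤ m = refl
  lastGap-omit (suc m) (suc x) (s≤s lt) = cong suc (lastGap-omit m x lt)

  size-omit : ∀ m x → x < m → ∣ omit m x ∣ + 1 ≡ m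
  size-omit (suc m) zero    lt       = trans (+-comm ∣ ⊤ {m} ∣ 1) (cong suc (∣⊤∣≡n m))
  size-omit (suc m) (suc x) (s≤s lt) = cong suc (size-omit m x lt)

  size-omit₂ : ∀ m x y → x < m → y < m → ¬ x ≡ y → ∣ omit₂ m x y ∣ + 2 ≡ m
  size-omit₂ (suc m) zero    zero    lx       ly       ne = ⊥-elim (ne refl)
  size-omit₂ (suc m) zero    (suc y) lx       (s≤s ly) ne = trans (+-suc ∣ omit m y ∣ 1) (cong suc (size-omit m y ly))
  size-omit₂ (suc m) (suc x) zero    (s≤s lx) ly       ne = trans (+-suc ∣ omit m x ∣ 1) (cong suc (size-omit m x lx))
  size-omit₂ (suc m) (suc x) (suc y) (s≤s lx) (s≤s ly) ne =
    cong suc (size-omit₂ m x y lx ly (λ eq → ne (cong suc eq)))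

  ⊆-omit₂ : ∀ {m} (v : Subset m) x y → v ⊆ᵇ omit m x ≡ true → v ⊆ᵇ omit m y ≡ true → v ⊆ᵇ omit₂ m x y ≡ true
  ⊆-omit₂ []          x       y       p q = refl
  ⊆-omit₂ (b ∷ v)     zero    zero    p q = p
  ⊆-omit₂ (false ∷ v) zero    (suc y) p q = q
  ⊆-omit₂ (false ∷ v) (suc x) zero    p q = p
  ⊆-omit₂ (false ∷ v) (suc x) (suc y) p q = ⊆-omit₂ v x y p q
  ⊆-omit₂ (true ∷ v)  (suc x) (suc y) p q = ⊆-omit₂ v x y p q

  omit₂⊆omit : ∀ m x y → omit₂ m x y ⊆ᵇ omit m x ≡ true
  omit₂⊆omit zero    x       y       = refl
  omit₂⊆omit (suc m) zero    zero    = ⊆-⊤ (⊤ {m})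
  omit₂⊆omit (suc m) zero    (suc y) = ⊆-⊤ (omit m y)
  omit₂⊆omit (suc m) (suc x) zero    = ⊆-refl (omit m x)
  omit₂⊆omit (suc m) (suc x) (suc y) = omit₂⊆omit m x y

  ΣupTo-⊆omit : ∀ {m} (v : Subset m) → ΣL (upTo m) (λ x → 𝟙 (v ⊆ᵇ omit m x)) ≡ gaps v
  ΣupTo-⊆omit []              = refl
  ΣupTo-⊆omit {suc m} (b ∷ v) =
    trans (ΣupTo-suc m (λ x → 𝟙 ((b ∷ v) ⊆ᵇ omit (suc m) x))) (cong₂ _+_ (first b) (rest b))
    where
    first : ∀ b → 𝟙 ((b ∷ v) ⊆ᵇ omit (suc m) 0) ≡ 𝟙 (not b)
    first true  = refl
    first false = cong 𝟙 (⊆-⊤ v)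
    rest : ∀ b → ΣL (upTo m) (λ x → 𝟙 ((b ∷ v) ⊆ᵇ omit (suc m) (suc x))) ≡ gaps v
    rest true  = ΣupTo-⊆omit v
    rest false = ΣupTo-⊆omit v

  ΣupTo-omit⊆omit : ∀ m y (g : ℕ → ℕ) → y < m → ΣL (upTo m) (λ x → 𝟙 (omit m y ⊆ᵇ omit m x) * g x) ≡ g y
  ΣupTo-omit⊆omit (suc m) zero g lt = begin
      ΣL (upTo (suc m)) (λ x → 𝟙 (omit (suc m) 0 ⊆ᵇ omit (suc m) x) * g x)
    ≡⟨ ΣupTo-suc m _ ⟩
      𝟙 (⊤ {m} ⊆ᵇ ⊤) * g 0 + ΣL (upTo m) (λ x → 𝟙 (⊤ ⊆ᵇ omit m x) * g (suc x))
    ≡⟨ cong₂ _+_ (trans (cong (λ b → 𝟙 b * g 0) (⊆-⊤ (⊤ {m}))) (+-identityʳ (g 0))) (⊤⊈omit m (λ x → g (suc x))) ⟩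
      g 0 + 0
    ≡⟨ +-identityʳ (g 0) ⟩
      g 0
    ∎
    where
    open ≡-Reasoning
    ⊤⊈omit : ∀ m (g : ℕ → ℕ) → ΣL (upTo m) (λ x → 𝟙 (⊤ ⊆ᵇ omit m x) * g x) ≡ 0
    ⊤⊈omit zero    g = refl
    ⊤⊈omit (suc m) g = trans (ΣupTo-suc m (λ x → 𝟙 (⊤ ⊆ᵇ omit (suc m) x) * g x)) (⊤⊈omit m (λ x → g (suc x)))
  ΣupTo-omit⊆omit (suc m) (suc y) g (s≤s lt) =
    trans (ΣupTo-suc m (λ x → 𝟙 (omit (suc m) (suc y) ⊆ᵇ omit (suc m) x) * g x))
          (ΣupTo-omit⊆omit m y (λ x → g (suc x)) lt)

  ΣupTo-omit₂⊆omit : ∀ m y q (g : ℕ → ℕ) → y < m → q < m → ¬ y ≡ q →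
                     ΣL (upTo m) (λ x → 𝟙 (omit₂ m y q ⊆ᵇ omit m x) * g x) ≡ g y + g q
  ΣupTo-omit₂⊆omit (suc m) zero zero g ly lq ne = ⊥-elim (ne refl)
  ΣupTo-omit₂⊆omit (suc m) zero (suc q) g ly (s≤s lq) ne =
    trans (ΣupTo-suc m (λ x → 𝟙 (omit₂ (suc m) 0 (suc q) ⊆ᵇ omit (suc m) x) * g x))
          (cong₂ _+_ (trans (cong (λ b → 𝟙 b * g 0) (⊆-⊤ (omit m q))) (+-identityʳ (g 0)))
                     (ΣupTo-omit⊆omit m q (λ x → g (suc x)) lq))
  ΣupTo-omit₂⊆omit (suc m) (suc y) zero g (s≤s ly) lq ne =
    trans (ΣupTo-suc m (λ x → 𝟙 (omit₂ (suc m) (suc y) 0 ⊆ᵇ omit (suc m) x) * g x))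
          (trans (cong₂ _+_ (trans (cong (λ b → 𝟙 b * g 0) (⊆-⊤ (omit m y))) (+-identityʳ (g 0)))
                            (ΣupTo-omit⊆omit m y (λ x → g (suc x)) ly))
                 (+-comm (g 0) _))
  ΣupTo-omit₂⊆omit (suc m) (suc y) (suc q) g (s≤s ly) (s≤s lq) ne =
    trans (ΣupTo-suc m (λ x → 𝟙 (omit₂ (suc m) (suc y) (suc q) ⊆ᵇ omit (suc m) x) * g x))
          (ΣupTo-omit₂⊆omit m y q (λ x → g (suc x)) ly lq (λ eq → ne (cong suc eq)))

  -- the subsets v of an m-block with firstGap v = a are {0,…,a-1} ∪ w for an arbitrary
  -- w ⊆ {a+1,…,m-1}; counted by size
  count-firstGap : ∀ m a (h : ℕ → ℕ) → a < m →
                   ΣS m (λ v → 𝟙 (firstGap v ≡ᵇ a) * h ∣ v ∣) ≡ bySize (m ∸ suc a) (λ t → h (a + t))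
  count-firstGap (suc m) zero    h lt       =
    trans (ΣS-suc m _) (ΣS-cong m (λ s → trans (+-identityʳ _) (+-identityʳ (h ∣ s ∣))))
  count-firstGap (suc m) (suc a) h (s≤s lt) = trans (ΣS-suc m _) (count-firstGap m a (λ t → h (suc t)) lt)

  ΣS-¬hasGap : ∀ m (g : Subset m → ℕ) → ΣS m (λ s → 𝟙 (not (hasGap s)) * g s) ≡ g ⊤
  ΣS-¬hasGap zero    g = trans (+-identityʳ _) (+-identityʳ (g []))
  ΣS-¬hasGap (suc m) g = trans (ΣS-suc m _) (ΣS-¬hasGap m (λ s → g (true ∷ s)))

  -- the subsets v with lastGap v = b < m are w ∪ {b+1,…,m-1} for an arbitrary w ⊆ {0,…,b-1}
  count-lastGap : ∀ m b (h : ℕ → ℕ) → b < m →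
                  ΣS m (λ v → 𝟙 (lastGap v ≡ᵇ b) * h ∣ v ∣) ≡ bySize b (λ t → h (m ∸ suc b + t))
  count-lastGap (suc m) zero h lt = begin
      ΣS (suc m) (λ v → 𝟙 (lastGap v ≡ᵇ 0) * h ∣ v ∣)
    ≡⟨ ΣS-suc m _ ⟩
      ΣS m (λ s → 𝟙 (lastGap (false ∷ s) ≡ᵇ 0) * h ∣ s ∣ + 0)
    ≡⟨ ΣS-cong m (λ s → trans (+-identityʳ _) (cong (λ b → 𝟙 b * h ∣ s ∣) (lastGap≡0 (hasGap s) (lastGap s)))) ⟩
      ΣS m (λ s → 𝟙 (not (hasGap s)) * h ∣ s ∣)
    ≡⟨ ΣS-¬hasGap m (λ s → h ∣ s ∣) ⟩
      h ∣ ⊤ {m} ∣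
    ≡⟨ cong h (trans (∣⊤∣≡n m) (sym (+-identityʳ m))) ⟩
      h (m + 0)
    ≡⟨ sym (+-identityʳ _) ⟩
      bySize 0 (λ t → h (suc m ∸ 1 + t))
    ∎
    where
    open ≡-Reasoning
    lastGap≡0 : ∀ c x → ((if c then suc x else 0) ≡ᵇ 0) ≡ not c
    lastGap≡0 true  x = refl
    lastGap≡0 false x = refl
  count-lastGap (suc m) (suc b) h (s≤s lt) = begin
      ΣS (suc m) (λ v → 𝟙 (lastGap v ≡ᵇ suc b) * h ∣ v ∣)
    ≡⟨ ΣS-suc m _ ⟩
      ΣS m (λ s → 𝟙 (lastGap (false ∷ s) ≡ᵇ suc b) * h ∣ s ∣ + 𝟙 (lastGap s ≡ᵇ b) * h (suc ∣ s ∣))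
    ≡⟨ ΣS-cong m (λ s → cong (λ z → 𝟙 z * h ∣ s ∣ + 𝟙 (lastGap s ≡ᵇ b) * h (suc ∣ s ∣)) (lastGap-false∷ s)) ⟩
      ΣS m (λ s → 𝟙 (lastGap s ≡ᵇ b) * h ∣ s ∣ + 𝟙 (lastGap s ≡ᵇ b) * h (suc ∣ s ∣))
    ≡⟨ ΣL-+ (allSubsets m) _ _ ⟩
      ΣS m (λ s → 𝟙 (lastGap s ≡ᵇ b) * h ∣ s ∣) + ΣS m (λ s → 𝟙 (lastGap s ≡ᵇ b) * h (suc ∣ s ∣))
    ≡⟨ cong₂ _+_ (count-lastGap m b h lt) (count-lastGap m b (λ t → h (suc t)) lt) ⟩
      bySize b (λ t → h (m ∸ suc b + t)) + bySize b (λ t → h (suc (m ∸ suc b + t)))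
    ≡⟨ cong (bySize b (λ t → h (m ∸ suc b + t)) +_) (bySize-cong b (λ t → cong h (sym (+-suc (m ∸ suc b) t)))) ⟩
      bySize b (λ t → h (m ∸ suc b + t)) + bySize b (λ t → h (m ∸ suc b + suc t))
    ≡⟨ sym (bySize-suc b (λ t → h (m ∸ suc b + t))) ⟩
      bySize (suc b) (λ t → h (suc m ∸ suc (suc b) + t))
    ∎
    where
    open ≡-Reasoning
    lastGap-false∷ : ∀ s → (lastGap (false ∷ s) ≡ᵇ suc b) ≡ (lastGap s ≡ᵇ b)
    lastGap-false∷ s with hasGap s in eq
    ... | true  = refl
    ... | false rewrite ¬hasGap⇒lastGap s eq = sym (≢⇒≡ᵇ-false m b (λ e → <⇒≢ lt (sym e)))

module Monomials where

  open Booleans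
  open Sums
  open import Data.Nat using (zero; suc; _+_; _*_; _≤_; z≤n; s≤s; _≡ᵇ_)
  open import Data.Nat.Properties
  open import Data.Bool using (true; false; _∧_)
  open import Data.List using (upTo; map)
  open import Data.List.Membership.Propositional using (_∈_; lose)
  open import Data.List.Membership.Propositional.Properties using (∈-concatMap⁺; ∈-map⁺; ∈-upTo⁺)
  open import Data.List.Relation.Unary.Any using (here)
  open import Data.Vec using ([]; _∷_; replicate)
  open import Data.Vec.Relation.Binary.Pointwise.Inductive using ([]; _∷_)

  deg-≤ : ∀ {n} (c a : Vec ℕ n) → IsCMono c a → deg a ≤ ∣ c ∣ᶜ
  deg-≤ []       []       []       = z≤n
  deg-≤ (c ∷ cs) (a ∷ as) (p ∷ ps) = +-mono-≤ p (deg-≤ cs as ps)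

  deg-≥⇒≡c : ∀ {n} (c a : Vec ℕ n) → IsCMono c a → ∣ c ∣ᶜ ≤ deg a → a ≡ c
  deg-≥⇒≡c []       []       []       _  = refl
  deg-≥⇒≡c (c ∷ cs) (a ∷ as) (p ∷ ps) le = cong₂ _∷_ a≡c (deg-≥⇒≡c cs as ps rest)
    where
    c≤a : c ≤ a
    c≤a = +-cancelʳ-≤ ∣ cs ∣ᶜ c a (≤-trans le (+-monoʳ-≤ a (deg-≤ cs as ps)))
    a≡c : a ≡ c
    a≡c = ≤-antisym p c≤a
    rest : ∣ cs ∣ᶜ ≤ deg as
    rest = +-cancelˡ-≤ c ∣ cs ∣ᶜ (deg as) (subst (λ z → c + ∣ cs ∣ᶜ ≤ z + deg as) a≡c le)

  ∣ᵐ-antisym : ∀ {n} {a b : Vec ℕ n} → a ∣ᵐ b → b ∣ᵐ a → a ≡ b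
  ∣ᵐ-antisym []       []       = refl
  ∣ᵐ-antisym (p ∷ ps) (q ∷ qs) = cong₂ _∷_ (≤-antisym p q) (∣ᵐ-antisym ps qs)

  _=ᵥ_ : ∀ {n} → Vec ℕ n → Vec ℕ n → Bool
  []       =ᵥ []       = true
  (a ∷ as) =ᵥ (b ∷ bs) = (a ≡ᵇ b) ∧ (as =ᵥ bs)

  =ᵥ⇒≡ : ∀ {n} (a b : Vec ℕ n) → a =ᵥ b ≡ true → a ≡ b
  =ᵥ⇒≡ []       []       p = refl
  =ᵥ⇒≡ (a ∷ as) (b ∷ bs) p = cong₂ _∷_ (≡ᵇ-true⇒≡ a b (∧-trueˡ p)) (=ᵥ⇒≡ as bs (∧-trueʳ {a ≡ᵇ b} p))

  =ᵥ-refl : ∀ {n} (a : Vec ℕ n) → a =ᵥ a ≡ true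
  =ᵥ-refl []       = refl
  =ᵥ-refl (a ∷ as) rewrite ≡⇒≡ᵇ-true a a refl = =ᵥ-refl as

  =ᵥ-sym : ∀ {n} (a b : Vec ℕ n) → (a =ᵥ b) ≡ (b =ᵥ a)
  =ᵥ-sym []       []       = refl
  =ᵥ-sym (a ∷ as) (b ∷ bs) = cong₂ _∧_ (≡ᵇ-sym a b) (=ᵥ-sym as bs)

  deg≡0 : ∀ {n} (a : Vec ℕ n) → (deg a ≡ᵇ 0) ≡ (a =ᵥ replicate n 0)
  deg≡0 []           = refl
  deg≡0 (zero ∷ as)  = deg≡0 as
  deg≡0 (suc x ∷ as) = refl

  1∣ᵐ : ∀ {n} (a : Vec ℕ n) → replicate n 0 ∣ᵐ a
  1∣ᵐ []       = []
  1∣ᵐ (a ∷ as) = z≤n ∷ 1∣ᵐ as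

  ∈cMonos : ∀ {n} (c a : Vec ℕ n) → IsCMono c a → a ∈ cMonos c
  ∈cMonos []       []       []          = here refl
  ∈cMonos (c ∷ cs) (a ∷ as) (a≤ ∷ as≤) =
    ∈-concatMap⁺ (λ x → map (x ∷_) (cMonos cs)) (lose (∈-upTo⁺ (s≤s a≤)) (∈-map⁺ (a ∷_) (∈cMonos cs as as≤)))

  ΣC-∷ : ∀ {n} (c : ℕ) (cs : Vec ℕ n) (g : Vec ℕ (suc n) → ℕ) →
         ΣL (cMonos (c ∷ cs)) g ≡ ΣL (upTo (suc c)) (λ x → ΣL (cMonos cs) (λ as → g (x ∷ as)))
  ΣC-∷ c cs g = trans (ΣL-concatMap (λ x → map (x ∷_) (cMonos cs)) (upTo (suc c)) g)
                      (ΣL-cong (upTo (suc c)) (λ x → ΣL-map (x ∷_) (cMonos cs) g))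

  ΣC-∷-* : ∀ {n} (c : ℕ) (cs : Vec ℕ n) (g : Vec ℕ (suc n) → ℕ) (u : ℕ → ℕ) (w : ℕ → Vec ℕ n → ℕ) →
           (∀ y as → g (y ∷ as) ≡ u y * w y as) →
           ΣL (cMonos (c ∷ cs)) g ≡ ΣL (upTo (suc c)) (λ y → u y * ΣL (cMonos cs) (w y))
  ΣC-∷-* c cs g u w eq =
    trans (ΣC-∷ c cs g) (ΣL-cong (upTo (suc c)) (λ y → trans (ΣL-cong (cMonos cs) (eq y)) (ΣL-*ˡ (cMonos cs) (u y) (w y))))

  ΣC-cong : ∀ {n} (c : Vec ℕ n) {f g : Vec ℕ n → ℕ} → (∀ a → IsCMono c a → f a ≡ g a) → ΣL (cMonos c) f ≡ ΣL (cMonos c) g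
  ΣC-cong []       eq = cong (_+ 0) (eq [] [])
  ΣC-cong (c ∷ cs) {f} {g} eq =
    trans (ΣC-∷ c cs f)
          (trans (ΣupTo-cong (suc c) (λ x lt → ΣC-cong cs (λ as p → eq (x ∷ as) (≤-pred lt ∷ p)))) (sym (ΣC-∷ c cs g)))

  ΣC-δ : ∀ {n} (c x : Vec ℕ n) (g : Vec ℕ n → ℕ) → IsCMono c x → ΣL (cMonos c) (λ a → 𝟙 (a =ᵥ x) * g a) ≡ g x
  ΣC-δ []       []       g []          = trans (+-identityʳ _) (+-identityʳ (g []))
  ΣC-δ (c ∷ cs) (x ∷ xs) g (x≤ ∷ xs≤) = begin
      ΣL (cMonos (c ∷ cs)) (λ a → 𝟙 (a =ᵥ (x ∷ xs)) * g a)
    ≡⟨ ΣC-∷-* c cs _ (λ y → 𝟙 (y ≡ᵇ x)) (λ y as → 𝟙 (as =ᵥ xs) * g (y ∷ as)) (λ y as → 𝟙-∧-* (y ≡ᵇ x) _ _) ⟩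
      ΣL (upTo (suc c)) (λ y → 𝟙 (y ≡ᵇ x) * ΣL (cMonos cs) (λ as → 𝟙 (as =ᵥ xs) * g (y ∷ as)))
    ≡⟨ ΣL-cong (upTo (suc c)) (λ y → cong (𝟙 (y ≡ᵇ x) *_) (ΣC-δ cs xs (λ as → g (y ∷ as)) xs≤)) ⟩
      ΣL (upTo (suc c)) (λ y → 𝟙 (y ≡ᵇ x) * g (y ∷ xs))
    ≡⟨ ΣupTo-δ (suc c) x (λ y → g (y ∷ xs)) (s≤s x≤) ⟩
      g (x ∷ xs)
    ∎
    where open ≡-Reasoning

  𝟙M-as-ΣC : ∀ {n} (c : Vec ℕ n) (M : Vec ℕ n → Bool) (h : Vec ℕ n → ℕ) → (∀ a → M a ≡ true → IsCMono c a) →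
             ∀ x → 𝟙 (M x) * h x ≡ ΣL (cMonos c) (λ a → 𝟙 (a =ᵥ x) * (𝟙 (M a) * h a))
  𝟙M-as-ΣC c M h onlyC x with M x in eq
  ... | true  = sym (trans (ΣC-δ c x (λ a → 𝟙 (M a) * h a) (onlyC x eq)) (cong (λ b → 𝟙 b * h x) eq))
  ... | false = sym (ΣL-zero (cMonos c) term)
    where
    term : ∀ a → 𝟙 (a =ᵥ x) * (𝟙 (M a) * h a) ≡ 0
    term a with a =ᵥ x in e
    ... | false = refl
    ... | true rewrite =ᵥ⇒≡ a x e | eq = refl

  ΣC-byDegree : ∀ {n} (c : Vec ℕ n) (M : Vec ℕ n → Bool) (g : ℕ → ℕ) →
                ΣL (cMonos c) (λ a → 𝟙 (M a) * g (deg a)) ≡ ΣL (upTo (suc ∣ c ∣ᶜ)) (λ i → fM c M i * g i)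
  ΣC-byDegree c M g = sym (begin
      ΣL (upTo (suc C)) (λ i → fM c M i * g i)
    ≡⟨ ΣL-cong (upTo (suc C)) (λ i → trans (cong (_* g i) (countᵇ-as-ΣL _ (cMonos c))) (sym (ΣL-*ʳ (cMonos c) (g i) _))) ⟩
      ΣL (upTo (suc C)) (λ i → ΣL (cMonos c) (λ a → 𝟙 (M a ∧ (deg a ≡ᵇ i)) * g i))
    ≡⟨ ΣL-swap (upTo (suc C)) (cMonos c) _ ⟩
      ΣL (cMonos c) (λ a → ΣL (upTo (suc C)) (λ i → 𝟙 (M a ∧ (deg a ≡ᵇ i)) * g i))
    ≡⟨ ΣC-cong c (λ a ac → trans (ΣL-cong (upTo (suc C)) (λ i → term a i))
                                 (trans (ΣL-*ˡ (upTo (suc C)) (𝟙 (M a)) _)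
                                        (cong (𝟙 (M a) *_) (ΣupTo-δ (suc C) (deg a) g (s≤s (deg-≤ c a ac)))))) ⟩
      ΣL (cMonos c) (λ a → 𝟙 (M a) * g (deg a))
    ∎)
    where
    open ≡-Reasoning
    C : ℕ
    C = ∣ c ∣ᶜ
    term : ∀ a i → 𝟙 (M a ∧ (deg a ≡ᵇ i)) * g i ≡ 𝟙 (M a) * (𝟙 (i ≡ᵇ deg a) * g i)
    term a i = trans (𝟙-∧-* (M a) (deg a ≡ᵇ i) (g i)) (cong (λ z → 𝟙 (M a) * (𝟙 z * g i)) (≡ᵇ-sym (deg a) i))

module Faces where

  open Booleans
  open Sums
  open Subsets
  open Blocks
  open Monomials
  open import Data.Nat using (suc; _+_; _*_; _≤_; s≤s)
  open import Data.Nat.Properties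
  open import Data.Bool using (true)
  open import Data.List using (upTo)
  open import Data.Vec using ([]; _∷_; _++_; take; drop)
  open import Data.Vec.Relation.Binary.Pointwise.Inductive using ([]; _∷_)
  open import Data.Fin.Subset using (Subset; ∣_∣)

  F : ∀ {n} (c a : Vec ℕ n) → Subset (Xsize c)
  F []       []       = []
  F (c ∷ cs) (a ∷ as) = omit (suc c) a ++ F cs as

  Fc≡F : ∀ {n} (c a : Vec ℕ n) → Fc c a ≡ F c a
  Fc≡F []       []       = refl
  Fc≡F (c ∷ cs) (a ∷ as) = cong₂ _++_ (tabulate-omit (suc c) a) (Fc≡F cs as)

  lo hi : ∀ {n} (c : Vec ℕ n) → Subset (Xsize c) → Vec ℕ n
  lo []       σ = []
  lo (c ∷ cs) σ = firstGap (take (suc c) σ) ∷ lo cs (drop (suc c) σ)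
  hi []       σ = []
  hi (c ∷ cs) σ = lastGap (take (suc c) σ) ∷ hi cs (drop (suc c) σ)

  ⊆F-lo : ∀ {n} (c : Vec ℕ n) σ → σ ⊆ᵇ F c (lo c σ) ≡ true
  ⊆F-lo []       [] = refl
  ⊆F-lo (c ∷ cs) σ  =
    trans (⊆-split (suc c) σ _ _) (∧-true (⊆-omit-firstGap (take (suc c) σ)) (⊆F-lo cs (drop (suc c) σ)))

  ⊆F-hi : ∀ {n} (c : Vec ℕ n) σ → σ ⊆ᵇ F c (hi c σ) ≡ true
  ⊆F-hi []       [] = refl
  ⊆F-hi (c ∷ cs) σ  =
    trans (⊆-split (suc c) σ _ _) (∧-true (⊆-omit-lastGap (take (suc c) σ)) (⊆F-hi cs (drop (suc c) σ)))

  lo-∣ : ∀ {n} (c a : Vec ℕ n) σ → IsCMono c a → σ ⊆ᵇ F c a ≡ true → lo c σ ∣ᵐ a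
  lo-∣ []       []       []  []          p = []
  lo-∣ (c ∷ cs) (a ∷ as) σ  (a≤ ∷ as≤) p rewrite ⊆-split (suc c) σ (omit (suc c) a) (F cs as) =
    firstGap-≤ (take (suc c) σ) a (∧-trueˡ p) (s≤s a≤) ∷ lo-∣ cs as (drop (suc c) σ) as≤ (∧-trueʳ p)

  ∣-hi : ∀ {n} (c a : Vec ℕ n) σ → IsCMono c a → σ ⊆ᵇ F c a ≡ true → a ∣ᵐ hi c σ
  ∣-hi []       []       []  []          p = []
  ∣-hi (c ∷ cs) (a ∷ as) σ  (a≤ ∷ as≤) p rewrite ⊆-split (suc c) σ (omit (suc c) a) (F cs as) =
    ≤-lastGap (take (suc c) σ) a (∧-trueˡ p) (s≤s a≤) ∷ ∣-hi cs as (drop (suc c) σ) as≤ (∧-trueʳ p)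

  lo-F : ∀ {n} (c a : Vec ℕ n) → IsCMono c a → lo c (F c a) ≡ a
  lo-F []       []       []          = refl
  lo-F (c ∷ cs) (a ∷ as) (a≤ ∷ as≤) = cong₂ _∷_
    (trans (cong firstGap (take-++ (suc c) (omit (suc c) a) (F cs as))) (firstGap-omit (suc c) a (s≤s a≤)))
    (trans (cong (lo cs) (drop-++ (suc c) (omit (suc c) a) (F cs as))) (lo-F cs as as≤))

  hi-F : ∀ {n} (c a : Vec ℕ n) → IsCMono c a → hi c (F c a) ≡ a
  hi-F []       []       []          = refl
  hi-F (c ∷ cs) (a ∷ as) (a≤ ∷ as≤) = cong₂ _∷_
    (trans (cong lastGap (take-++ (suc c) (omit (suc c) a) (F cs as))) (lastGap-omit (suc c) a (s≤s a≤)))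
    (trans (cong (hi cs) (drop-++ (suc c) (omit (suc c) a) (F cs as))) (hi-F cs as as≤))

  hi-isCMono : ∀ {n} (c : Vec ℕ n) σ → IsCMono c (lo c σ) → IsCMono c (hi c σ)
  hi-isCMono []       []  []       = []
  hi-isCMono (c ∷ cs) σ  (p ∷ ps) =
    ≤-pred (firstGap<⇒lastGap< (take (suc c) σ) (s≤s p)) ∷ hi-isCMono cs (drop (suc c) σ) ps

  F-injective : ∀ {n} (c a b : Vec ℕ n) → IsCMono c a → IsCMono c b → F c a ⊆ᵇ F c b ≡ true → a ≡ b
  F-injective c a b ca cb p = ∣ᵐ-antisym (subst (_∣ᵐ b) (lo-F c a ca) (lo-∣ c b (F c a) cb p))
                                         (subst (b ∣ᵐ_) (hi-F c a ca) (∣-hi c b (F c a) cb p))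

  size-F : ∀ {n} (c a : Vec ℕ n) → IsCMono c a → ∣ F c a ∣ ≡ ∣ c ∣ᶜ
  size-F []       []       []          = refl
  size-F (c ∷ cs) (a ∷ as) (a≤ ∷ as≤) = trans (size-++ (omit (suc c) a) (F cs as))
    (cong₂ _+_ (+-cancelʳ-≡ 1 _ _ (trans (size-omit (suc c) a (s≤s a≤)) (+-comm 1 c))) (size-F cs as as≤))

  ΣC-F⊆F : ∀ {n} (c b : Vec ℕ n) (g : Vec ℕ n → ℕ) → IsCMono c b →
           ΣL (cMonos c) (λ a → 𝟙 (F c b ⊆ᵇ F c a) * g a) ≡ g b
  ΣC-F⊆F []       []       g []          = trans (+-identityʳ _) (+-identityʳ (g []))
  ΣC-F⊆F (c ∷ cs) (b ∷ bs) g (b≤ ∷ bs≤) = begin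
      ΣL (cMonos (c ∷ cs)) (λ a → 𝟙 (F (c ∷ cs) (b ∷ bs) ⊆ᵇ F (c ∷ cs) a) * g a)
    ≡⟨ ΣC-∷-* c cs _ (λ y → 𝟙 (omit (suc c) b ⊆ᵇ omit (suc c) y)) (λ y as → 𝟙 (F cs bs ⊆ᵇ F cs as) * g (y ∷ as))
              (λ y as → trans (cong (λ z → 𝟙 z * g (y ∷ as)) (⊆-++ (omit (suc c) b) (omit (suc c) y) (F cs bs) (F cs as)))
                              (𝟙-∧-* (omit (suc c) b ⊆ᵇ omit (suc c) y) (F cs bs ⊆ᵇ F cs as) (g (y ∷ as)))) ⟩
      ΣL (upTo (suc c)) (λ y → 𝟙 (omit (suc c) b ⊆ᵇ omit (suc c) y) * ΣL (cMonos cs) (λ as → 𝟙 (F cs bs ⊆ᵇ F cs as) * g (y ∷ as)))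
    ≡⟨ ΣL-cong (upTo (suc c)) (λ y → cong (𝟙 (omit (suc c) b ⊆ᵇ omit (suc c) y) *_) (ΣC-F⊆F cs bs (λ as → g (y ∷ as)) bs≤)) ⟩
      ΣL (upTo (suc c)) (λ y → 𝟙 (omit (suc c) b ⊆ᵇ omit (suc c) y) * g (y ∷ bs))
    ≡⟨ ΣupTo-omit⊆omit (suc c) b (λ y → g (y ∷ bs)) (s≤s b≤) ⟩
      g (b ∷ bs)
    ∎
    where open ≡-Reasoning

  coverCount : ∀ {n} (c : Vec ℕ n) → Subset (Xsize c) → ℕ
  coverCount []       τ = 1
  coverCount (c ∷ cs) τ = gaps (take (suc c) τ) * coverCount cs (drop (suc c) τ)

  ΣC-⊆F : ∀ {n} (c : Vec ℕ n) τ → ΣL (cMonos c) (λ a → 𝟙 (τ ⊆ᵇ F c a)) ≡ coverCount c τ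
  ΣC-⊆F []       [] = refl
  ΣC-⊆F (c ∷ cs) τ  = begin
      ΣL (cMonos (c ∷ cs)) (λ a → 𝟙 (τ ⊆ᵇ F (c ∷ cs) a))
    ≡⟨ ΣC-∷-* c cs _ (λ y → 𝟙 (take (suc c) τ ⊆ᵇ omit (suc c) y)) (λ _ as → 𝟙 (drop (suc c) τ ⊆ᵇ F cs as))
              (λ y as → trans (cong 𝟙 (⊆-split (suc c) τ (omit (suc c) y) (F cs as)))
                              (𝟙-∧ (take (suc c) τ ⊆ᵇ omit (suc c) y) (drop (suc c) τ ⊆ᵇ F cs as))) ⟩
      ΣL (upTo (suc c)) (λ y → 𝟙 (take (suc c) τ ⊆ᵇ omit (suc c) y) * rest)
    ≡⟨ ΣL-*ʳ (upTo (suc c)) rest (λ y → 𝟙 (take (suc c) τ ⊆ᵇ omit (suc c) y)) ⟩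
      ΣL (upTo (suc c)) (λ y → 𝟙 (take (suc c) τ ⊆ᵇ omit (suc c) y)) * rest
    ≡⟨ cong₂ _*_ (ΣupTo-⊆omit (take (suc c) τ)) (ΣC-⊆F cs (drop (suc c) τ)) ⟩
      coverCount (c ∷ cs) τ
    ∎
    where
    open ≡-Reasoning
    rest : ℕ
    rest = ΣL (cMonos cs) (λ as → 𝟙 (drop (suc c) τ ⊆ᵇ F cs as))

  -- a face lying in exactly one F_c(a) has a single gap in each block, hence |c| vertices
  coverCount≡1⇒size : ∀ {n} (c : Vec ℕ n) τ → coverCount c τ ≡ 1 → ∣ τ ∣ ≡ ∣ c ∣ᶜ
  coverCount≡1⇒size []       [] p = refl
  coverCount≡1⇒size (c ∷ cs) τ  p = trans (size-take-drop (suc c) τ)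
    (cong₂ _+_ block (coverCount≡1⇒size cs (drop (suc c) τ) (m*n≡1⇒n≡1 (gaps (take (suc c) τ)) _ p)))
    where
    oneGap : gaps (take (suc c) τ) ≡ 1
    oneGap = m*n≡1⇒m≡1 (gaps (take (suc c) τ)) (coverCount cs (drop (suc c) τ)) p
    block : ∣ take (suc c) τ ∣ ≡ c
    block = +-cancelʳ-≡ 1 _ _
      (trans (trans (cong (∣ take (suc c) τ ∣ +_) (sym oneGap)) (size+gaps (take (suc c) τ))) (+-comm 1 c))

-- If σ sits between lo σ ∈ M and hi σ ∉ M, walking from
-- lo σ to hi σ one coordinate at a time crosses the boundary of M at some a ∈ M with
-- a[j]≔(hi σ)_j ∉ M, and σ lies in the corresponding ridge.
module Ridges where

  open Booleans
  open Sums
  open Subsets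
  open Blocks
  open Monomials
  open Faces
  open import Data.Nat using (suc; _+_; _*_; _≤_; s≤s)
  open import Data.Nat.Properties
  open import Data.Bool using (true; false; _∧_)
  open import Data.List using (upTo)
  open import Data.Vec using ([]; _∷_; _++_; take; drop; lookup; _[_]≔_)
  open import Data.Vec.Relation.Binary.Pointwise.Inductive using (_∷_)
  open import Data.Fin using (Fin; zero; suc)
  open import Data.Fin.Subset using (Subset; ∣_∣)
  open import Data.Product using (Σ; _×_; _,_)
  open import Relation.Nullary using (¬_)

  ridge : ∀ {n} (c a : Vec ℕ n) → Fin n → ℕ → Subset (Xsize c)
  ridge (c ∷ cs) (a ∷ as) zero    q = omit₂ (suc c) a q ++ F cs as
  ridge (c ∷ cs) (a ∷ as) (suc j) q = omit (suc c) a ++ ridge cs as j q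

  ⊆-ridge : ∀ {n} (c a : Vec ℕ n) j q σ →
            σ ⊆ᵇ F c a ≡ true → σ ⊆ᵇ F c (a [ j ]≔ q) ≡ true → σ ⊆ᵇ ridge c a j q ≡ true
  ⊆-ridge (c ∷ cs) (a ∷ as) zero q σ p p'
    rewrite ⊆-split (suc c) σ (omit (suc c) a) (F cs as) | ⊆-split (suc c) σ (omit (suc c) q) (F cs as)
          | ⊆-split (suc c) σ (omit₂ (suc c) a q) (F cs as)
    = ∧-true (⊆-omit₂ (take (suc c) σ) a q (∧-trueˡ p) (∧-trueˡ p')) (∧-trueʳ p)
  ⊆-ridge (c ∷ cs) (a ∷ as) (suc j) q σ p p'
    rewrite ⊆-split (suc c) σ (omit (suc c) a) (F cs as) | ⊆-split (suc c) σ (omit (suc c) a) (F cs (as [ j ]≔ q))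
          | ⊆-split (suc c) σ (omit (suc c) a) (ridge cs as j q)
    = ∧-true (∧-trueˡ p) (⊆-ridge cs as j q (drop (suc c) σ) (∧-trueʳ p) (∧-trueʳ p'))

  ridge⊆F : ∀ {n} (c a : Vec ℕ n) j q → ridge c a j q ⊆ᵇ F c a ≡ true
  ridge⊆F (c ∷ cs) (a ∷ as) zero    q = trans (⊆-++ (omit₂ (suc c) a q) (omit (suc c) a) (F cs as) (F cs as))
                                              (∧-true (omit₂⊆omit (suc c) a q) (⊆-refl (F cs as)))
  ridge⊆F (c ∷ cs) (a ∷ as) (suc j) q = trans (⊆-++ (omit (suc c) a) (omit (suc c) a) (ridge cs as j q) (F cs as))
                                              (∧-true (⊆-refl (omit (suc c) a)) (ridge⊆F cs as j q))

  size-ridge : ∀ {n} (c a : Vec ℕ n) j q → IsCMono c a → q ≤ lookup c j → ¬ q ≡ lookup a j →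
               ∣ ridge c a j q ∣ + 1 ≡ ∣ c ∣ᶜ
  size-ridge (c ∷ cs) (a ∷ as) zero q (a≤ ∷ as≤) q≤ ne = begin
      ∣ omit₂ (suc c) a q ++ F cs as ∣ + 1
    ≡⟨ cong (_+ 1) (size-++ (omit₂ (suc c) a q) (F cs as)) ⟩
      ∣ omit₂ (suc c) a q ∣ + ∣ F cs as ∣ + 1
    ≡⟨ trans (+-assoc ∣ omit₂ (suc c) a q ∣ _ 1) (cong (∣ omit₂ (suc c) a q ∣ +_) (+-comm ∣ F cs as ∣ 1)) ⟩
      ∣ omit₂ (suc c) a q ∣ + (1 + ∣ F cs as ∣)
    ≡⟨ sym (+-assoc ∣ omit₂ (suc c) a q ∣ 1 _) ⟩
      ∣ omit₂ (suc c) a q ∣ + 1 + ∣ F cs as ∣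
    ≡⟨ cong₂ _+_ block (size-F cs as as≤) ⟩
      c + ∣ cs ∣ᶜ
    ∎
    where
    open ≡-Reasoning
    block : ∣ omit₂ (suc c) a q ∣ + 1 ≡ c
    block = suc-injective (trans (sym (+-suc ∣ omit₂ (suc c) a q ∣ 1))
                                 (size-omit₂ (suc c) a q (s≤s a≤) (s≤s q≤) (λ e → ne (sym e))))
  size-ridge (c ∷ cs) (a ∷ as) (suc j) q (a≤ ∷ as≤) q≤ ne = begin
      ∣ omit (suc c) a ++ ridge cs as j q ∣ + 1
    ≡⟨ cong (_+ 1) (size-++ (omit (suc c) a) (ridge cs as j q)) ⟩
      ∣ omit (suc c) a ∣ + ∣ ridge cs as j q ∣ + 1
    ≡⟨ +-assoc ∣ omit (suc c) a ∣ _ 1 ⟩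
      ∣ omit (suc c) a ∣ + (∣ ridge cs as j q ∣ + 1)
    ≡⟨ cong₂ _+_ block (size-ridge cs as j q as≤ q≤ ne) ⟩
      c + ∣ cs ∣ᶜ
    ∎
    where
    open ≡-Reasoning
    block : ∣ omit (suc c) a ∣ ≡ c
    block = +-cancelʳ-≡ 1 _ _ (trans (size-omit (suc c) a (s≤s a≤)) (+-comm 1 c))

  ridge-facets : ∀ {n} (c a : Vec ℕ n) j q (P : Vec ℕ n → Bool) → IsCMono c a → q ≤ lookup c j → ¬ q ≡ lookup a j →
                 P a ≡ true → P (a [ j ]≔ q) ≡ false → ΣL (cMonos c) (λ a' → 𝟙 (P a' ∧ (ridge c a j q ⊆ᵇ F c a'))) ≡ 1
  ridge-facets (c ∷ cs) (a ∷ as) zero q P (a≤ ∷ as≤) q≤ ne pa pq = begin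
      ΣL (cMonos (c ∷ cs)) (λ a' → 𝟙 (P a' ∧ (ridge (c ∷ cs) (a ∷ as) zero q ⊆ᵇ F (c ∷ cs) a')))
    ≡⟨ ΣC-∷-* c cs _ (λ x → 𝟙 (omit₂ (suc c) a q ⊆ᵇ omit (suc c) x)) (λ x as' → 𝟙 (P (x ∷ as') ∧ (F cs as ⊆ᵇ F cs as')))
              (λ x as' → trans (cong (λ z → 𝟙 (P (x ∷ as') ∧ z)) (⊆-++ (omit₂ (suc c) a q) (omit (suc c) x) (F cs as) (F cs as')))
                               (𝟙-∧-middle (P (x ∷ as')) (omit₂ (suc c) a q ⊆ᵇ omit (suc c) x) (F cs as ⊆ᵇ F cs as'))) ⟩
      ΣL (upTo (suc c)) (λ x → 𝟙 (omit₂ (suc c) a q ⊆ᵇ omit (suc c) x) * ΣL (cMonos cs) (λ as' → 𝟙 (P (x ∷ as') ∧ (F cs as ⊆ᵇ F cs as'))))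
    ≡⟨ ΣL-cong (upTo (suc c)) (λ x → cong (𝟙 (omit₂ (suc c) a q ⊆ᵇ omit (suc c) x) *_) (onlyFacet x)) ⟩
      ΣL (upTo (suc c)) (λ x → 𝟙 (omit₂ (suc c) a q ⊆ᵇ omit (suc c) x) * 𝟙 (P (x ∷ as)))
    ≡⟨ ΣupTo-omit₂⊆omit (suc c) a q (λ x → 𝟙 (P (x ∷ as))) (s≤s a≤) (s≤s q≤) (λ e → ne (sym e)) ⟩
      𝟙 (P (a ∷ as)) + 𝟙 (P (q ∷ as))
    ≡⟨ cong₂ (λ u v → 𝟙 u + 𝟙 v) pa pq ⟩
      1
    ∎
    where
    open ≡-Reasoning
    onlyFacet : ∀ x → ΣL (cMonos cs) (λ as' → 𝟙 (P (x ∷ as') ∧ (F cs as ⊆ᵇ F cs as'))) ≡ 𝟙 (P (x ∷ as))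
    onlyFacet x = trans (ΣL-cong (cMonos cs) (λ as' → trans (𝟙-∧ (P (x ∷ as')) _) (*-comm (𝟙 (P (x ∷ as'))) _)))
                        (ΣC-F⊆F cs as (λ as' → 𝟙 (P (x ∷ as'))) as≤)
  ridge-facets (c ∷ cs) (a ∷ as) (suc j) q P (a≤ ∷ as≤) q≤ ne pa pq = begin
      ΣL (cMonos (c ∷ cs)) (λ a' → 𝟙 (P a' ∧ (ridge (c ∷ cs) (a ∷ as) (suc j) q ⊆ᵇ F (c ∷ cs) a')))
    ≡⟨ ΣC-∷-* c cs _ (λ x → 𝟙 (omit (suc c) a ⊆ᵇ omit (suc c) x)) (λ x as' → 𝟙 (P (x ∷ as') ∧ (ridge cs as j q ⊆ᵇ F cs as')))
              (λ x as' → trans (cong (λ z → 𝟙 (P (x ∷ as') ∧ z)) (⊆-++ (omit (suc c) a) (omit (suc c) x) (ridge cs as j q) (F cs as')))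
                               (𝟙-∧-middle (P (x ∷ as')) (omit (suc c) a ⊆ᵇ omit (suc c) x) (ridge cs as j q ⊆ᵇ F cs as'))) ⟩
      ΣL (upTo (suc c)) (λ x → 𝟙 (omit (suc c) a ⊆ᵇ omit (suc c) x) * ΣL (cMonos cs) (λ as' → 𝟙 (P (x ∷ as') ∧ (ridge cs as j q ⊆ᵇ F cs as'))))
    ≡⟨ ΣupTo-omit⊆omit (suc c) a _ (s≤s a≤) ⟩
      ΣL (cMonos cs) (λ as' → 𝟙 (P (a ∷ as') ∧ (ridge cs as j q ⊆ᵇ F cs as')))
    ≡⟨ ridge-facets cs as j q (λ y → P (a ∷ y)) as≤ q≤ ne pa pq ⟩
      1
    ∎
    where open ≡-Reasoning

  data Picks : ∀ {n} → Vec ℕ n → Vec ℕ n → Vec ℕ n → Set where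
    []ᵖ   : Picks [] [] []
    pickˡ : ∀ {n u v} {us vs as : Vec ℕ n} → Picks us vs as → Picks (u ∷ us) (v ∷ vs) (u ∷ as)
    pickʳ : ∀ {n u v} {us vs as : Vec ℕ n} → Picks us vs as → Picks (u ∷ us) (v ∷ vs) (v ∷ as)

  picks-left : ∀ {n} (u v : Vec ℕ n) → Picks u v u
  picks-left []       []       = []ᵖ
  picks-left (u ∷ us) (v ∷ vs) = pickˡ (picks-left us vs)

  picks-upd : ∀ {n} {u v a : Vec ℕ n} → Picks u v a → ∀ j → Picks u v (a [ j ]≔ lookup v j)
  picks-upd (pickˡ m) zero    = pickʳ m
  picks-upd (pickʳ m) zero    = pickʳ m
  picks-upd (pickˡ m) (suc j) = pickˡ (picks-upd m j)
  picks-upd (pickʳ m) (suc j) = pickʳ (picks-upd m j)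

  picks⇒⊆F : ∀ {n} (c : Vec ℕ n) σ a → Picks (lo c σ) (hi c σ) a → σ ⊆ᵇ F c a ≡ true
  picks⇒⊆F []       [] [] []ᵖ = refl
  picks⇒⊆F (c ∷ cs) σ (a ∷ as) (pickˡ m) =
    trans (⊆-split (suc c) σ _ _) (∧-true (⊆-omit-firstGap (take (suc c) σ)) (picks⇒⊆F cs (drop (suc c) σ) as m))
  picks⇒⊆F (c ∷ cs) σ (a ∷ as) (pickʳ m) =
    trans (⊆-split (suc c) σ _ _) (∧-true (⊆-omit-lastGap (take (suc c) σ)) (picks⇒⊆F cs (drop (suc c) σ) as m))

  crossing : ∀ {n} (P : Vec ℕ n → Bool) (u v : Vec ℕ n) → P u ≡ true → P v ≡ false →
             Σ (Vec ℕ n) λ a → Σ (Fin n) λ j → Picks u v a × P a ≡ true × P (a [ j ]≔ lookup v j) ≡ false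
  crossing P []       []       pu pv with () ← trans (sym pv) pu
  crossing P (u ∷ us) (v ∷ vs) pu pv with P (v ∷ us) in eq
  ... | false = (u ∷ us) , zero , pickˡ (picks-left us vs) , pu , eq
  ... | true with crossing (λ x → P (v ∷ x)) us vs eq pv
  ...   | a , j , m , pa , pa' = (v ∷ a) , suc j , pickʳ m , pa , pa'

module Characterisation {n} (c : Vec ℕ n) (M : Vec ℕ n → Bool) (mc : IsCMulticomplex c M) where

  open IsCMulticomplex mc
  open Booleans
  open Sums
  open Subsets
  open Monomials
  open Faces
  open Ridges
  open import Data.Nat using (suc; _*_; _∸_; _≤_; _≡ᵇ_)
  open import Data.Nat.Properties using (*-zeroʳ; *-identityʳ; m+n∸n≡m)
  open import Data.Bool using (true; false; _∧_; _∨_; not)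
  open import Data.Bool.Properties using (∧-assoc; ∧-zeroʳ)
  open import Data.Bool.ListAction using (any)
  open import Data.Vec using (lookup; _[_]≔_)
  open import Data.Vec.Properties using ([]≔-lookup)
  open import Data.Vec.Relation.Binary.Pointwise.Inductive as Pointwise using ()
  open import Data.Fin.Subset using (Subset; ∣_∣)
  open import Data.Product using (_,_)
  open import Relation.Nullary using (¬_)
  open import Data.Empty using (⊥-elim)

  N : ℕ
  N = Xsize c

  -- σ ∈ B_c(M) iff lo σ ∈ M: lo σ divides every a with σ ⊆ F_c(a), and σ ⊆ F_c(lo σ)
  Bc≡M∘lo : ∀ σ → Bc c M σ ≡ M (lo c σ)
  Bc≡M∘lo σ = trans (any-cong _ _ (cMonos c) (λ a → cong (λ z → M a ∧ (σ ⊆ᵇ z)) (Fc≡F c a))) (bool-ext to from)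
    where
    to : any (λ a → M a ∧ (σ ⊆ᵇ F c a)) (cMonos c) ≡ true → M (lo c σ) ≡ true
    to h with any-elim _ (cMonos c) h
    ... | a , _ , ha = divClosed (lo c σ) a (∧-trueˡ ha) (lo-∣ c a σ (onlyCMonos a (∧-trueˡ ha)) (∧-trueʳ {M a} ha))
    from : M (lo c σ) ≡ true → any (λ a → M a ∧ (σ ⊆ᵇ F c a)) (cMonos c) ≡ true
    from h = any-intro _ (cMonos c) (lo c σ) (∈cMonos c (lo c σ) (onlyCMonos _ h)) (∧-true h (⊆F-lo c σ))

  isFacet-Bc : ∀ S → isFacet (Bc c M) S ≡ M (lo c S) ∧ (S =ᵇ F c (lo c S))
  isFacet-Bc S = bool-ext to from
    where
    to : isFacet (Bc c M) S ≡ true → M (lo c S) ∧ (S =ᵇ F c (lo c S)) ≡ true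
    to h = ∧-true loS∈M (trans (=ᵇ-sym S (F c (lo c S))) (⇒-elim F∈Bc⊇S S-maximal))
      where
      loS∈M : M (lo c S) ≡ true
      loS∈M = trans (sym (Bc≡M∘lo S)) (∧-trueˡ h)
      S-maximal : not (Bc c M (F c (lo c S)) ∧ (S ⊆ᵇ F c (lo c S))) ∨ (F c (lo c S) =ᵇ S) ≡ true
      S-maximal = all-elim _ (allSubsets N) (∧-trueʳ {Bc c M S} h) _ (∈allSubsets N _)
      F∈Bc⊇S : Bc c M (F c (lo c S)) ∧ (S ⊆ᵇ F c (lo c S)) ≡ true
      F∈Bc⊇S = ∧-true (trans (Bc≡M∘lo _) (trans (cong M (lo-F c (lo c S) (onlyCMonos _ loS∈M))) loS∈M)) (⊆F-lo c S)
    from : M (lo c S) ∧ (S =ᵇ F c (lo c S)) ≡ true → isFacet (Bc c M) S ≡ true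
    from h = ∧-true (trans (Bc≡M∘lo S) loS∈M) (all-intro _ (allSubsets N) (λ T _ → ⇒-intro (Bc c M T ∧ (S ⊆ᵇ T)) (maximal T)))
      where
      loS∈M = ∧-trueˡ h
      S≡F : S ≡ F c (lo c S)
      S≡F = =ᵇ⇒≡ S _ (∧-trueʳ {M (lo c S)} h)
      -- a face T ⊇ S = F_c(lo S) of B_c(M) has F_c(lo S) ⊆ F_c(lo T), so lo T = lo S and T ⊆ S
      maximal : ∀ T → Bc c M T ∧ (S ⊆ᵇ T) ≡ true → T =ᵇ S ≡ true
      maximal T x = ∧-true (subst (λ z → T ⊆ᵇ z ≡ true) (trans (cong (F c) (sym loS≡loT)) (sym S≡F)) (⊆F-lo c T)) S⊆T
        where
        S⊆T : S ⊆ᵇ T ≡ true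
        S⊆T = ∧-trueʳ {Bc c M T} x
        loS≡loT : lo c S ≡ lo c T
        loS≡loT = F-injective c _ _ (onlyCMonos _ loS∈M) (onlyCMonos _ (trans (sym (Bc≡M∘lo T)) (∧-trueˡ x)))
                                (subst (λ z → z ⊆ᵇ F c (lo c T) ≡ true) S≡F (⊆-trans S T _ S⊆T (⊆F-lo c T)))

  facetCount : Subset N → ℕ
  facetCount τ = countᵇ (λ S → isFacet (Bc c M) S ∧ (τ ⊆ᵇ S)) (allSubsets N)

  facetCount≡ : ∀ τ → facetCount τ ≡ ΣL (cMonos c) (λ a → 𝟙 (M a ∧ (τ ⊆ᵇ F c a)))
  facetCount≡ τ = begin
      facetCount τ
    ≡⟨ countᵇ-as-ΣL _ (allSubsets N) ⟩
      ΣS N (λ S → 𝟙 (isFacet (Bc c M) S ∧ (τ ⊆ᵇ S)))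
    ≡⟨ ΣS-cong N facetAsSum ⟩
      ΣS N (λ S → ΣL (cMonos c) (λ a → 𝟙 (M a ∧ (τ ⊆ᵇ F c a)) * 𝟙 (S =ᵇ F c a)))
    ≡⟨ ΣL-swap (allSubsets N) (cMonos c) _ ⟩
      ΣL (cMonos c) (λ a → ΣS N (λ S → 𝟙 (M a ∧ (τ ⊆ᵇ F c a)) * 𝟙 (S =ᵇ F c a)))
    ≡⟨ ΣL-cong (cMonos c) (λ a → trans (ΣL-*ˡ (allSubsets N) (𝟙 (M a ∧ (τ ⊆ᵇ F c a))) (λ S → 𝟙 (S =ᵇ F c a)))
                                       (trans (cong (𝟙 (M a ∧ (τ ⊆ᵇ F c a)) *_) (ΣS-=ᵇ N (F c a))) (*-identityʳ _))) ⟩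
      ΣL (cMonos c) (λ a → 𝟙 (M a ∧ (τ ⊆ᵇ F c a)))
    ∎
    where
    open ≡-Reasoning
    term : ∀ S a → IsCMono c a → 𝟙 (a =ᵥ lo c S) * (𝟙 (M a) * 𝟙 ((S =ᵇ F c a) ∧ (τ ⊆ᵇ S)))
                               ≡ 𝟙 (M a ∧ (τ ⊆ᵇ F c a)) * 𝟙 (S =ᵇ F c a)
    term S a ac with S =ᵇ F c a in e
    ... | false = trans (cong (𝟙 (a =ᵥ lo c S) *_) (*-zeroʳ (𝟙 (M a))))
                        (trans (*-zeroʳ (𝟙 (a =ᵥ lo c S))) (sym (*-zeroʳ (𝟙 (M a ∧ (τ ⊆ᵇ F c a))))))
    ... | true with =ᵇ⇒≡ S _ e
    ...   | refl rewrite lo-F c a ac | =ᵥ-refl a with M a | τ ⊆ᵇ F c a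
    ...     | true  | true  = refl
    ...     | true  | false = refl
    ...     | false | _     = refl
    facetAsSum : ∀ S → 𝟙 (isFacet (Bc c M) S ∧ (τ ⊆ᵇ S))
                       ≡ ΣL (cMonos c) (λ a → 𝟙 (M a ∧ (τ ⊆ᵇ F c a)) * 𝟙 (S =ᵇ F c a))
    facetAsSum S = begin
        𝟙 (isFacet (Bc c M) S ∧ (τ ⊆ᵇ S))
      ≡⟨ cong (λ z → 𝟙 (z ∧ (τ ⊆ᵇ S))) (isFacet-Bc S) ⟩
        𝟙 ((M (lo c S) ∧ (S =ᵇ F c (lo c S))) ∧ (τ ⊆ᵇ S))
      ≡⟨ trans (cong 𝟙 (∧-assoc (M (lo c S)) _ _)) (𝟙-∧ (M (lo c S)) _) ⟩
        𝟙 (M (lo c S)) * 𝟙 ((S =ᵇ F c (lo c S)) ∧ (τ ⊆ᵇ S))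
      ≡⟨ 𝟙M-as-ΣC c M (λ a → 𝟙 ((S =ᵇ F c a) ∧ (τ ⊆ᵇ S))) onlyCMonos (lo c S) ⟩
        ΣL (cMonos c) (λ a → 𝟙 (a =ᵥ lo c S) * (𝟙 (M a) * 𝟙 ((S =ᵇ F c a) ∧ (τ ⊆ᵇ S))))
      ≡⟨ ΣC-cong c (term S) ⟩
        ΣL (cMonos c) (λ a → 𝟙 (M a ∧ (τ ⊆ᵇ F c a)) * 𝟙 (S =ᵇ F c a))
      ∎

  -- if σ ⊆ τ and hi σ ∈ M then every facet F_c(a) ⊇ τ belongs to B_c(M)
  facetCount-hi∈M : ∀ σ τ → σ ⊆ᵇ τ ≡ true → M (hi c σ) ≡ true → facetCount τ ≡ coverCount c τ
  facetCount-hi∈M σ τ σ⊆τ hiσ∈M = trans (facetCount≡ τ) (trans (ΣC-cong c allIn) (ΣC-⊆F c τ))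
    where
    allIn : ∀ a → IsCMono c a → 𝟙 (M a ∧ (τ ⊆ᵇ F c a)) ≡ 𝟙 (τ ⊆ᵇ F c a)
    allIn a ac with τ ⊆ᵇ F c a in τ⊆F
    ... | false = cong 𝟙 (∧-zeroʳ (M a))
    ... | true rewrite divClosed a (hi c σ) hiσ∈M (∣-hi c a σ ac (⊆-trans σ τ _ σ⊆τ τ⊆F)) = refl

  Bier⇒ : 1 ≤ ∣ c ∣ᶜ → ∀ σ → Bier c M σ ≡ true → M (lo c σ) ∧ not (M (hi c σ)) ≡ true
  Bier⇒ C≥1 σ h with any-elim _ (allSubsets N) h
  ... | τ , _ , hτ = ∧-true loσ∈M (cong not hiσ∉M)
    where
    size-τ : (∣ τ ∣ ≡ᵇ (∣ c ∣ᶜ ∸ 1)) ≡ true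
    size-τ = ∧-trueˡ hτ
    τ∈Bc : Bc c M τ ≡ true
    τ∈Bc = ∧-trueˡ (∧-trueʳ {∣ τ ∣ ≡ᵇ (∣ c ∣ᶜ ∸ 1)} hτ)
    oneFacet : (facetCount τ ≡ᵇ 1) ≡ true
    oneFacet = ∧-trueˡ (∧-trueʳ {Bc c M τ} (∧-trueʳ {∣ τ ∣ ≡ᵇ (∣ c ∣ᶜ ∸ 1)} hτ))
    σ⊆τ : σ ⊆ᵇ τ ≡ true
    σ⊆τ = ∧-trueʳ {facetCount τ ≡ᵇ 1} (∧-trueʳ {Bc c M τ} (∧-trueʳ {∣ τ ∣ ≡ᵇ (∣ c ∣ᶜ ∸ 1)} hτ))
    loτ∈M : M (lo c τ) ≡ true
    loτ∈M = trans (sym (Bc≡M∘lo τ)) τ∈Bc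
    loσ∈M : M (lo c σ) ≡ true
    loσ∈M = divClosed (lo c σ) (lo c τ) loτ∈M (lo-∣ c (lo c τ) σ (onlyCMonos _ loτ∈M) (⊆-trans σ τ _ σ⊆τ (⊆F-lo c τ)))
    -- were hi σ ∈ M, τ would lie in a single F_c(a) and so have |c| vertices
    hiσ∉M : M (hi c σ) ≡ false
    hiσ∉M with M (hi c σ) in e
    ... | false = refl
    ... | true  = ⊥-elim (noFixedPoint C≥1 (trans (sym |τ|≡C) (≡ᵇ-true⇒≡ _ _ size-τ)))
      where
      |τ|≡C : ∣ τ ∣ ≡ ∣ c ∣ᶜ
      |τ|≡C = coverCount≡1⇒size c τ (trans (sym (facetCount-hi∈M σ τ σ⊆τ e)) (≡ᵇ-true⇒≡ _ 1 oneFacet))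
      noFixedPoint : ∀ {C} → 1 ≤ C → ¬ C ≡ C ∸ 1
      noFixedPoint {suc C} _ ()

  -- conversely, crossing from lo σ ∈ M to hi σ ∉ M yields a ridge containing σ in one facet
  ⇒Bier : ∀ σ → M (lo c σ) ∧ not (M (hi c σ)) ≡ true → Bier c M σ ≡ true
  ⇒Bier σ h with crossing M (lo c σ) (hi c σ) (∧-trueˡ h) (not-true (∧-trueʳ {M (lo c σ)} h))
  ... | a , j , picks , a∈M , a'∉M =
    any-intro _ (allSubsets N) τ (∈allSubsets N τ) (∧-true size-τ (∧-true τ∈Bc (∧-true oneFacet σ⊆τ)))
    where
    q : ℕ
    q = lookup (hi c σ) j
    q≤ : q ≤ lookup c j
    q≤ = Pointwise.lookup (hi-isCMono c σ (onlyCMonos _ (∧-trueˡ h))) j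
    ac : IsCMono c a
    ac = onlyCMonos a a∈M
    q≢ : ¬ q ≡ lookup a j
    q≢ e with () ← trans (sym a'∉M) (trans (cong (λ z → M (a [ j ]≔ z)) e) (trans (cong M ([]≔-lookup a j)) a∈M))
    τ : Subset N
    τ = ridge c a j q
    σ⊆τ : σ ⊆ᵇ τ ≡ true
    σ⊆τ = ⊆-ridge c a j q σ (picks⇒⊆F c σ a picks) (picks⇒⊆F c σ (a [ j ]≔ q) (picks-upd picks j))
    size-τ : (∣ τ ∣ ≡ᵇ (∣ c ∣ᶜ ∸ 1)) ≡ true
    size-τ = ≡⇒≡ᵇ-true _ _ (trans (sym (m+n∸n≡m ∣ τ ∣ 1)) (cong (_∸ 1) (size-ridge c a j q ac q≤ q≢)))
    τ∈Bc : Bc c M τ ≡ true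
    τ∈Bc = trans (Bc≡M∘lo τ) (divClosed (lo c τ) a a∈M (lo-∣ c a τ ac (ridge⊆F c a j q)))
    oneFacet : (facetCount τ ≡ᵇ 1) ≡ true
    oneFacet = ≡⇒≡ᵇ-true _ _ (trans (facetCount≡ τ) (ridge-facets c a j q M ac q≤ q≢ a∈M a'∉M))

  Bier≡ : 1 ≤ ∣ c ∣ᶜ → ∀ σ → Bier c M σ ≡ M (lo c σ) ∧ not (M (hi c σ))
  Bier≡ C≥1 σ = bool-ext (Bier⇒ C≥1 σ) (⇒Bier σ)

-- Counting faces by size through lo and hi: the faces σ with lo σ = a are F_c(a) minus
-- any set of vertices x_i^(j) with j > a_i, those with hi σ = b are F_c(b) minus any set
-- of vertices with j < b_i.
module FaceCounts where

  open Booleans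
  open Sums
  open Subsets
  open Blocks
  open Monomials
  open Faces
  open import Data.Nat using (zero; suc; _+_; _*_; _∸_; _≤_; z≤n; s≤s; _≡ᵇ_)
  open import Data.Nat.Properties
  open import Data.Nat.Tactic.RingSolver using (solve-∀)
  open import Data.Vec using ([]; _∷_; _++_)
  open import Data.Vec.Relation.Binary.Pointwise.Inductive using ([]; _∷_)
  open import Data.Fin.Subset using (Subset; ∣_∣)

  ∸-+-∸ : ∀ c a d b → a ≤ c → b ≤ d → (c ∸ a) + (d ∸ b) ≡ (c + d) ∸ (a + b)
  ∸-+-∸ c       zero    d b z≤n       b≤d = sym (+-∸-assoc c b≤d)
  ∸-+-∸ (suc c) (suc a) d b (s≤s a≤c) b≤d = ∸-+-∸ c a d b a≤c b≤d

  regroup : ∀ p t₁ q t₂ → p + t₁ + (q + t₂) ≡ p + q + (t₁ + t₂)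
  regroup = solve-∀

  lo-++ : ∀ {n} c (cs : Vec ℕ n) (v : Subset (suc c)) (u : Subset (Xsize cs)) → lo (c ∷ cs) (v ++ u) ≡ firstGap v ∷ lo cs u
  lo-++ c cs v u = cong₂ (λ x y → firstGap x ∷ lo cs y) (take-++ (suc c) v u) (drop-++ (suc c) v u)

  hi-++ : ∀ {n} c (cs : Vec ℕ n) (v : Subset (suc c)) (u : Subset (Xsize cs)) → hi (c ∷ cs) (v ++ u) ≡ lastGap v ∷ hi cs u
  hi-++ c cs v u = cong₂ (λ x y → lastGap x ∷ hi cs y) (take-++ (suc c) v u) (drop-++ (suc c) v u)

  ΣS-firstBlock : ∀ {n} c (cs : Vec ℕ n) (φ : Subset (Xsize (c ∷ cs)) → Vec ℕ (suc n))
                  (g : Subset (suc c) → ℕ) (φ' : Subset (Xsize cs) → Vec ℕ n) →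
                  (∀ v u → φ (v ++ u) ≡ g v ∷ φ' u) → ∀ a as (w : ℕ → ℕ) →
                  ΣS (Xsize (c ∷ cs)) (λ σ → 𝟙 (φ σ =ᵥ (a ∷ as)) * w ∣ σ ∣)
                  ≡ ΣS (suc c) (λ v → 𝟙 (g v ≡ᵇ a) * ΣS (Xsize cs) (λ u → 𝟙 (φ' u =ᵥ as) * w (∣ v ∣ + ∣ u ∣)))
  ΣS-firstBlock c cs φ g φ' split a as w =
    trans (ΣS-++ (suc c) (Xsize cs) _)
          (ΣS-cong (suc c) (λ v → trans (ΣS-cong (Xsize cs) (term v)) (ΣL-*ˡ (allSubsets (Xsize cs)) (𝟙 (g v ≡ᵇ a)) _)))
    where
    term : ∀ v u → 𝟙 (φ (v ++ u) =ᵥ (a ∷ as)) * w ∣ v ++ u ∣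
                 ≡ 𝟙 (g v ≡ᵇ a) * (𝟙 (φ' u =ᵥ as) * w (∣ v ∣ + ∣ u ∣))
    term v u = trans (cong₂ (λ x y → 𝟙 (x =ᵥ (a ∷ as)) * w y) (split v u) (size-++ v u))
                     (𝟙-∧-* (g v ≡ᵇ a) (φ' u =ᵥ as) (w (∣ v ∣ + ∣ u ∣)))

  count-lo : ∀ {n} (c a : Vec ℕ n) (w : ℕ → ℕ) → IsCMono c a →
             ΣS (Xsize c) (λ σ → 𝟙 (lo c σ =ᵥ a) * w ∣ σ ∣) ≡ bySize (∣ c ∣ᶜ ∸ deg a) (λ t → w (deg a + t))
  count-lo []       []       w []          = cong (_+ 0) (+-identityʳ (w 0))
  count-lo (c ∷ cs) (a ∷ as) w (a≤ ∷ as≤) = begin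
      ΣS (Xsize (c ∷ cs)) (λ σ → 𝟙 (lo (c ∷ cs) σ =ᵥ (a ∷ as)) * w ∣ σ ∣)
    ≡⟨ ΣS-firstBlock c cs (lo (c ∷ cs)) firstGap (lo cs) (lo-++ c cs) a as w ⟩
      ΣS (suc c) (λ v → 𝟙 (firstGap v ≡ᵇ a) * ΣS (Xsize cs) (λ u → 𝟙 (lo cs u =ᵥ as) * w (∣ v ∣ + ∣ u ∣)))
    ≡⟨ ΣS-cong (suc c) (λ v → cong (𝟙 (firstGap v ≡ᵇ a) *_) (count-lo cs as (λ s → w (∣ v ∣ + s)) as≤)) ⟩
      ΣS (suc c) (λ v → 𝟙 (firstGap v ≡ᵇ a) * rest ∣ v ∣)
    ≡⟨ count-firstGap (suc c) a rest (s≤s a≤) ⟩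
      bySize (c ∸ a) (λ t₁ → rest (a + t₁))
    ≡⟨ bySize-cong (c ∸ a) (λ t₁ → bySize-cong (∣ cs ∣ᶜ ∸ deg as) (λ t₂ → cong w (regroup a t₁ (deg as) t₂))) ⟩
      bySize (c ∸ a) (λ t₁ → bySize (∣ cs ∣ᶜ ∸ deg as) (λ t₂ → w (a + deg as + (t₁ + t₂))))
    ≡⟨ sym (bySize-++ (c ∸ a) (∣ cs ∣ᶜ ∸ deg as) (λ t → w (a + deg as + t))) ⟩
      bySize ((c ∸ a) + (∣ cs ∣ᶜ ∸ deg as)) (λ t → w (a + deg as + t))
    ≡⟨ bySize-dim (λ t → w (a + deg as + t)) (∸-+-∸ c a ∣ cs ∣ᶜ (deg as) a≤ (deg-≤ cs as as≤)) ⟩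
      bySize (∣ c ∷ cs ∣ᶜ ∸ deg (a ∷ as)) (λ t → w (deg (a ∷ as) + t))
    ∎
    where
    open ≡-Reasoning
    rest : ℕ → ℕ
    rest s = bySize (∣ cs ∣ᶜ ∸ deg as) (λ t → w (s + (deg as + t)))

  count-hi : ∀ {n} (c b : Vec ℕ n) (w : ℕ → ℕ) → IsCMono c b →
             ΣS (Xsize c) (λ σ → 𝟙 (hi c σ =ᵥ b) * w ∣ σ ∣) ≡ bySize (deg b) (λ t → w (∣ c ∣ᶜ ∸ deg b + t))
  count-hi []       []       w []          = cong (_+ 0) (+-identityʳ (w 0))
  count-hi (c ∷ cs) (b ∷ bs) w (b≤ ∷ bs≤) = begin
      ΣS (Xsize (c ∷ cs)) (λ σ → 𝟙 (hi (c ∷ cs) σ =ᵥ (b ∷ bs)) * w ∣ σ ∣)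
    ≡⟨ ΣS-firstBlock c cs (hi (c ∷ cs)) lastGap (hi cs) (hi-++ c cs) b bs w ⟩
      ΣS (suc c) (λ v → 𝟙 (lastGap v ≡ᵇ b) * ΣS (Xsize cs) (λ u → 𝟙 (hi cs u =ᵥ bs) * w (∣ v ∣ + ∣ u ∣)))
    ≡⟨ ΣS-cong (suc c) (λ v → cong (𝟙 (lastGap v ≡ᵇ b) *_) (count-hi cs bs (λ s → w (∣ v ∣ + s)) bs≤)) ⟩
      ΣS (suc c) (λ v → 𝟙 (lastGap v ≡ᵇ b) * rest ∣ v ∣)
    ≡⟨ count-lastGap (suc c) b rest (s≤s b≤) ⟩
      bySize b (λ t₁ → rest (c ∸ b + t₁))
    ≡⟨ bySize-cong b (λ t₁ → bySize-cong (deg bs) (λ t₂ → cong w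
         (trans (regroup (c ∸ b) t₁ (∣ cs ∣ᶜ ∸ deg bs) t₂) (cong (_+ (t₁ + t₂)) (∸-+-∸ c b ∣ cs ∣ᶜ (deg bs) b≤ (deg-≤ cs bs bs≤)))))) ⟩
      bySize b (λ t₁ → bySize (deg bs) (λ t₂ → w ((c + ∣ cs ∣ᶜ) ∸ (b + deg bs) + (t₁ + t₂))))
    ≡⟨ sym (bySize-++ b (deg bs) (λ t → w ((c + ∣ cs ∣ᶜ) ∸ (b + deg bs) + t))) ⟩
      bySize (deg (b ∷ bs)) (λ t → w (∣ c ∷ cs ∣ᶜ ∸ deg (b ∷ bs) + t))
    ∎
    where
    open ≡-Reasoning
    rest : ℕ → ℕ
    rest s = bySize (deg bs) (λ t → w (s + (∣ cs ∣ᶜ ∸ deg bs + t)))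

-- Every face of
-- Bier_c(M) is a face of B_c(M); the remaining faces of B_c(M) are those with hi σ ∈ M,
-- whose f-vector is fUpper.
module FVectors {n} (c : Vec ℕ n) (M : Vec ℕ n → Bool) (mc : IsCMulticomplex c M) where

  open IsCMulticomplex mc
  open Booleans
  open Sums
  open HVectors using (hVec-cong; hVec-+; hVec-sbin-mixture)
  open Binomials using (sbin; bySize-sbin)
  open Monomials
  open Faces
  open FaceCounts
  open Characterisation c M mc
  open import Data.Nat as ℕ using (_*_; _∸_; _≤_; s≤s; _≡ᵇ_)
  open import Data.Nat.Properties using (*-comm; ≤-pred; m∸n≤m; m∸[m∸n]≡n; +-identityʳ)
  open import Data.Integer as ℤ using (+_; _-_)
  open import Data.Integer.Tactic.RingSolver using (solve-∀)
  import Data.Nat.Tactic.RingSolver as ℕ-Solver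
  open import Data.Bool using (true; false; _∧_; not)
  open import Data.List using (upTo)
  open import Data.List.Membership.Propositional.Properties using (∈-upTo⁻)
  open import Data.Vec using (replicate)
  open import Data.Fin.Subset using (Subset; ∣_∣)
  open import Data.Product using (proj₁; proj₂)

  C : ℕ
  C = ∣ c ∣ᶜ

  countVia : (φ : Subset N → Vec ℕ n) (Q : Vec ℕ n → (ℕ → ℕ) → ℕ) →
             (∀ a w → IsCMono c a → ΣS N (λ σ → 𝟙 (φ σ =ᵥ a) * w ∣ σ ∣) ≡ Q a w) →
             ∀ w → ΣS N (λ σ → 𝟙 (M (φ σ)) * w ∣ σ ∣) ≡ ΣL (cMonos c) (λ a → 𝟙 (M a) * Q a w)
  countVia φ Q fibre w = begin
      ΣS N (λ σ → 𝟙 (M (φ σ)) * w ∣ σ ∣)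
    ≡⟨ ΣS-cong N (λ σ → 𝟙M-as-ΣC c M (λ _ → w ∣ σ ∣) onlyCMonos (φ σ)) ⟩
      ΣS N (λ σ → ΣL (cMonos c) (λ a → 𝟙 (a =ᵥ φ σ) * (𝟙 (M a) * w ∣ σ ∣)))
    ≡⟨ ΣL-swap (allSubsets N) (cMonos c) _ ⟩
      ΣL (cMonos c) (λ a → ΣS N (λ σ → 𝟙 (a =ᵥ φ σ) * (𝟙 (M a) * w ∣ σ ∣)))
    ≡⟨ ΣL-cong (cMonos c) (λ a → trans (ΣS-cong N (λ σ → reorder a σ)) (ΣL-*ˡ (allSubsets N) (𝟙 (M a)) _)) ⟩
      ΣL (cMonos c) (λ a → 𝟙 (M a) * ΣS N (λ σ → 𝟙 (φ σ =ᵥ a) * w ∣ σ ∣))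
    ≡⟨ ΣC-cong c (λ a ac → cong (𝟙 (M a) *_) (fibre a w ac)) ⟩
      ΣL (cMonos c) (λ a → 𝟙 (M a) * Q a w)
    ∎
    where
    open ≡-Reasoning
    swap : ∀ x y z → x * (y * z) ≡ y * (x * z)
    swap = ℕ-Solver.solve-∀
    reorder : ∀ a σ → 𝟙 (a =ᵥ φ σ) * (𝟙 (M a) * w ∣ σ ∣) ≡ 𝟙 (M a) * (𝟙 (φ σ =ᵥ a) * w ∣ σ ∣)
    reorder a σ = trans (swap (𝟙 (a =ᵥ φ σ)) (𝟙 (M a)) _) (cong (λ z → 𝟙 (M a) * (𝟙 z * w ∣ σ ∣)) (=ᵥ-sym a (φ σ)))

  f-Bc : ∀ k → fFam (Bc c M) k ≡ ΣL (upTo (ℕ.suc C)) (λ i → fM c M i * sbin (C ∸ i) i k)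
  f-Bc k = begin
      fFam (Bc c M) k
    ≡⟨ countᵇ-as-ΣL _ (allSubsets N) ⟩
      ΣS N (λ σ → 𝟙 (Bc c M σ ∧ (∣ σ ∣ ≡ᵇ k)))
    ≡⟨ ΣS-cong N (λ σ → trans (cong (λ z → 𝟙 (z ∧ (∣ σ ∣ ≡ᵇ k))) (Bc≡M∘lo σ)) (𝟙-∧ (M (lo c σ)) (∣ σ ∣ ≡ᵇ k))) ⟩
      ΣS N (λ σ → 𝟙 (M (lo c σ)) * 𝟙 (∣ σ ∣ ≡ᵇ k))
    ≡⟨ countVia (lo c) (λ a w → bySize (C ∸ deg a) (λ t → w (deg a ℕ.+ t))) (count-lo c) (λ s → 𝟙 (s ≡ᵇ k)) ⟩
      ΣL (cMonos c) (λ a → 𝟙 (M a) * bySize (C ∸ deg a) (λ t → 𝟙 (deg a ℕ.+ t ≡ᵇ k)))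
    ≡⟨ ΣL-cong (cMonos c) (λ a → cong (𝟙 (M a) *_) (bySize-sbin (C ∸ deg a) (deg a) k)) ⟩
      ΣL (cMonos c) (λ a → 𝟙 (M a) * sbin (C ∸ deg a) (deg a) k)
    ≡⟨ ΣC-byDegree c M (λ i → sbin (C ∸ i) i k) ⟩
      ΣL (upTo (ℕ.suc C)) (λ i → fM c M i * sbin (C ∸ i) i k)
    ∎
    where open ≡-Reasoning

  fUpper : ℕ → ℕ
  fUpper k = ΣL (upTo (ℕ.suc C)) (λ i → fM c M i * sbin (C ∸ (C ∸ i)) (C ∸ i) k)

  f-Bc≡f-Bier+fUpper : 1 ≤ C → ∀ k → fFam (Bc c M) k ≡ fFam (Bier c M) k ℕ.+ fUpper k
  f-Bc≡f-Bier+fUpper C≥1 k = begin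
      fFam (Bc c M) k
    ≡⟨ countᵇ-as-ΣL _ (allSubsets N) ⟩
      ΣS N (λ σ → 𝟙 (Bc c M σ ∧ (∣ σ ∣ ≡ᵇ k)))
    ≡⟨ ΣS-cong N (λ σ → trans (cong (λ z → 𝟙 (z ∧ (∣ σ ∣ ≡ᵇ k))) (Bc≡M∘lo σ))
                              (trans (split (M (lo c σ)) (M (hi c σ)) (∣ σ ∣ ≡ᵇ k) (hi∈M⇒lo∈M σ))
                                     (cong (λ z → 𝟙 (z ∧ (∣ σ ∣ ≡ᵇ k)) ℕ.+ 𝟙 (M (hi c σ)) * 𝟙 (∣ σ ∣ ≡ᵇ k)) (sym (Bier≡ C≥1 σ))))) ⟩
      ΣS N (λ σ → 𝟙 (Bier c M σ ∧ (∣ σ ∣ ≡ᵇ k)) ℕ.+ 𝟙 (M (hi c σ)) * 𝟙 (∣ σ ∣ ≡ᵇ k))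
    ≡⟨ ΣL-+ (allSubsets N) _ _ ⟩
      ΣS N (λ σ → 𝟙 (Bier c M σ ∧ (∣ σ ∣ ≡ᵇ k))) ℕ.+ ΣS N (λ σ → 𝟙 (M (hi c σ)) * 𝟙 (∣ σ ∣ ≡ᵇ k))
    ≡⟨ cong₂ ℕ._+_ (sym (countᵇ-as-ΣL _ (allSubsets N)))
                   (countVia (hi c) (λ a w → bySize (deg a) (λ t → w (C ∸ deg a ℕ.+ t))) (count-hi c) (λ s → 𝟙 (s ≡ᵇ k))) ⟩
      fFam (Bier c M) k ℕ.+ ΣL (cMonos c) (λ a → 𝟙 (M a) * bySize (deg a) (λ t → 𝟙 (C ∸ deg a ℕ.+ t ≡ᵇ k)))
    ≡⟨ cong (fFam (Bier c M) k ℕ.+_)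
            (trans (ΣL-cong (cMonos c) (λ a → cong (𝟙 (M a) *_) (bySize-sbin (deg a) (C ∸ deg a) k)))
                   (ΣC-byDegree c M (λ i → sbin i (C ∸ i) k))) ⟩
      fFam (Bier c M) k ℕ.+ ΣL (upTo (ℕ.suc C)) (λ i → fM c M i * sbin i (C ∸ i) k)
    ≡⟨ cong (fFam (Bier c M) k ℕ.+_)
            (ΣupTo-cong (ℕ.suc C) (λ i lt → cong (λ z → fM c M i * sbin z (C ∸ i) k) (sym (m∸[m∸n]≡n (≤-pred lt))))) ⟩
      fFam (Bier c M) k ℕ.+ fUpper k
    ∎
    where
    open ≡-Reasoning
    hi∈M⇒lo∈M : ∀ σ → M (hi c σ) ≡ true → M (lo c σ) ≡ true
    hi∈M⇒lo∈M σ h = divClosed (lo c σ) (hi c σ) h (lo-∣ c (hi c σ) σ (onlyCMonos _ h) (⊆F-hi c σ))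
    split : ∀ L H s → (H ≡ true → L ≡ true) → 𝟙 (L ∧ s) ≡ 𝟙 ((L ∧ not H) ∧ s) ℕ.+ 𝟙 H * 𝟙 s
    split true  false s _ = sym (+-identityʳ (𝟙 s))
    split false false s _ = refl
    split true  true  s _ = sym (+-identityʳ (𝟙 s))
    split false true  s h with () ← h refl

  -- f_0(M) = 1: M is nonempty and closed under divisors
  fM-0≡1 : fM c M 0 ≡ 1
  fM-0≡1 = begin
      fM c M 0
    ≡⟨ countᵇ-as-ΣL _ (cMonos c) ⟩
      ΣL (cMonos c) (λ a → 𝟙 (M a ∧ (deg a ≡ᵇ 0)))
    ≡⟨ ΣL-cong (cMonos c) (λ a → trans (cong (λ z → 𝟙 (M a ∧ z)) (deg≡0 a)) (trans (𝟙-∧ (M a) _) (*-comm (𝟙 (M a)) _))) ⟩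
      ΣL (cMonos c) (λ a → 𝟙 (a =ᵥ replicate n 0) * 𝟙 (M a))
    ≡⟨ ΣC-δ c (replicate n 0) (λ a → 𝟙 (M a)) (1∣ᵐ c) ⟩
      𝟙 (M (replicate n 0))
    ≡⟨ cong 𝟙 (divClosed (replicate n 0) (proj₁ nonempty) (proj₂ nonempty) (1∣ᵐ _)) ⟩
      1
    ∎
    where open ≡-Reasoning

  h-Bc : ∀ i → i ≤ C → hVec C (fFam (Bc c M)) i ≡ + fM c M i
  h-Bc i i≤C = begin
      hVec C (fFam (Bc c M)) i
    ≡⟨ hVec-cong C i f-Bc ⟩
      hVec C (λ l → ΣL (upTo (ℕ.suc C)) (λ j → fM c M j * sbin (C ∸ j) j l)) i
    ≡⟨ hVec-sbin-mixture C i (upTo (ℕ.suc C)) (fM c M) (λ j → j) (λ j j∈ → ≤-pred (∈-upTo⁻ j∈)) i≤C ⟩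
      + ΣL (upTo (ℕ.suc C)) (λ j → fM c M j * 𝟙 (j ≡ᵇ i))
    ≡⟨ cong +_ (trans (ΣL-cong (upTo (ℕ.suc C)) (λ j → *-comm (fM c M j) _)) (ΣupTo-δ (ℕ.suc C) i (fM c M) (s≤s i≤C))) ⟩
      + fM c M i
    ∎
    where open ≡-Reasoning

  h-fUpper : ∀ k → k ≤ C → hVec C fUpper k ≡ + fM c M (C ∸ k)
  h-fUpper k k≤C = begin
      hVec C fUpper k
    ≡⟨ hVec-sbin-mixture C k (upTo (ℕ.suc C)) (fM c M) (λ i → C ∸ i) (λ i _ → m∸n≤m C i) k≤C ⟩
      + ΣL (upTo (ℕ.suc C)) (λ i → fM c M i * 𝟙 (C ∸ i ≡ᵇ k))
    ≡⟨ cong +_ (trans (ΣupTo-cong (ℕ.suc C) (λ i lt → trans (*-comm (fM c M i) _) (cong (λ z → 𝟙 z * fM c M i) (flip i (≤-pred lt)))))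
                      (ΣupTo-δ (ℕ.suc C) (C ∸ k) (fM c M) (s≤s (m∸n≤m C k)))) ⟩
      + fM c M (C ∸ k)
    ∎
    where
    open ≡-Reasoning
    flip : ∀ i → i ≤ C → (C ∸ i ≡ᵇ k) ≡ (i ≡ᵇ C ∸ k)
    flip i i≤C = bool-ext
      (λ h → ≡⇒≡ᵇ-true i (C ∸ k) (trans (sym (m∸[m∸n]≡n i≤C)) (cong (C ∸_) (≡ᵇ-true⇒≡ (C ∸ i) k h))))
      (λ h → ≡⇒≡ᵇ-true (C ∸ i) k (trans (cong (C ∸_) (≡ᵇ-true⇒≡ i (C ∸ k) h)) (m∸[m∸n]≡n k≤C)))

  h-Bier : 1 ≤ C → ∀ k → k ≤ C → hVec C (fFam (Bier c M)) k ≡ + fM c M k - + fM c M (C ∸ k)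
  h-Bier C≥1 k k≤C = begin
      hVec C (fFam (Bier c M)) k
    ≡⟨ cancel (hVec C (fFam (Bier c M)) k) (hVec C fUpper k) ⟩
      hVec C (fFam (Bier c M)) k ℤ.+ hVec C fUpper k - hVec C fUpper k
    ≡⟨ cong (_- hVec C fUpper k) (sym (trans (hVec-cong C k (f-Bc≡f-Bier+fUpper C≥1)) (hVec-+ C k (fFam (Bier c M)) fUpper))) ⟩
      hVec C (fFam (Bc c M)) k - hVec C fUpper k
    ≡⟨ cong₂ _-_ (h-Bc k k≤C) (h-fUpper k k≤C) ⟩
      + fM c M k - + fM c M (C ∸ k)
    ∎
    where
    open ≡-Reasoning
    cancel : ∀ a b → a ≡ a ℤ.+ b - b
    cancel = solve-∀

-- Properness of M means x^c ∉ M; hence |c| ≥ 1 and f_{|c|}(M) = 0.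
module Properness {n} (c : Vec ℕ n) (M : Vec ℕ n → Bool) (mc : IsCMulticomplex c M) (proper : IsProper c M) where

  open IsCMulticomplex mc
  open Booleans
  open Sums
  open Monomials
  open import Data.Nat using (zero; suc; _≤_; z≤n; s≤s; _≡ᵇ_)
  open import Data.Nat.Properties using (≤-reflexive)
  open import Data.Bool using (true; false; _∧_)
  open import Data.Bool.Properties using (∧-zeroʳ)
  open import Data.Product using (_,_; proj₁; proj₂)
  open import Data.Empty using (⊥-elim)
  open import Relation.Nullary using (¬_)

  -- x^c ∉ M: it would be divisible by the monomial witnessing properness
  top∉M : M c ≡ false
  top∉M with M c in c∈M
  ... | false = refl
  ... | true  = ⊥-elim (a∉M (divClosed a c c∈M a≤c))
    where
    a : Vec ℕ n
    a   = proj₁ proper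
    a≤c : IsCMono c a
    a≤c = proj₁ (proj₂ proper)
    a∉M : ¬ (a ∈ᵐ M)
    a∉M = proj₂ (proj₂ proper)

  -- |c| ≥ 1, since otherwise every c-monomial equals x^c
  C≥1 : 1 ≤ ∣ c ∣ᶜ
  C≥1 with ∣ c ∣ᶜ in C≡0 | nonempty
  ... | suc _ | _        = s≤s z≤n
  ... | zero  | a , a∈M
    with () ← trans (sym top∉M)
                    (subst (λ z → M z ≡ true) (deg-≥⇒≡c c a (onlyCMonos a a∈M) (subst (_≤ deg a) (sym C≡0) z≤n)) a∈M)

  -- f_{|c|}(M) = 0, as x^c is the only c-monomial of degree |c|
  fM-C≡0 : fM c M ∣ c ∣ᶜ ≡ 0
  fM-C≡0 = trans (countᵇ-as-ΣL _ (cMonos c)) (trans (ΣC-cong c term) (ΣL-zero (cMonos c) (λ _ → refl)))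
    where
    term : ∀ a → IsCMono c a → 𝟙 (M a ∧ (deg a ≡ᵇ ∣ c ∣ᶜ)) ≡ 0
    term a ac with deg a ≡ᵇ ∣ c ∣ᶜ in e
    ... | false = cong 𝟙 (∧-zeroʳ (M a))
    ... | true rewrite deg-≥⇒≡c c a ac (≤-reflexive (sym (≡ᵇ-true⇒≡ _ _ e))) | top∉M = refl

open import Data.Nat using (_≤_; _∸_; _/_; zero; suc)
open import Data.Nat.Properties using (≤-trans; m∸n≤m; m+[n∸m]≡n)
open import Data.Nat.DivMod using (m/n≤m)
open import Data.Integer using (+_; _-_)
open import Data.Product using (_×_; _,_)
open HVectors using (g≡h-suc)

theorem1p14 : (n : ℕ) (c : Vec ℕ n) (M : Vec ℕ n → Bool) →
    IsCMulticomplex c M → IsProper c M →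
    ((i : ℕ) → i ≤ ∣ c ∣ᶜ → hVec ∣ c ∣ᶜ (fFam (Bc c M)) i ≡ + fM c M i)
    × ((i : ℕ) → i ≤ (∣ c ∣ᶜ ∸ 1) / 2 →
        gVec (∣ c ∣ᶜ ∸ 1) (fFam (Bier c M)) i ≡ + fM c M i - + fM c M (∣ c ∣ᶜ ∸ i))
theorem1p14 n c M mc proper = h-Bc , g-Bier
  where
  open FVectors c M mc
  open Properness c M mc proper
  -- g_0 = 1 = f_0 - f_C; for i ≥ 1, g_i in dimension C - 1 is h_i in dimension C
  g-Bier : (i : ℕ) → i ≤ (C ∸ 1) / 2 → gVec (C ∸ 1) (fFam (Bier c M)) i ≡ + fM c M i - + fM c M (C ∸ i)
  g-Bier zero    _ = cong₂ (λ x y → + x - + y) (sym fM-0≡1) (sym fM-C≡0)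
  g-Bier (suc k) i≤ = begin
      gVec (C ∸ 1) (fFam (Bier c M)) (suc k)
    ≡⟨ g≡h-suc (C ∸ 1) k (fFam (Bier c M)) i≤C-1 ⟩
      hVec (suc (C ∸ 1)) (fFam (Bier c M)) (suc k)
    ≡⟨ cong (λ d → hVec d (fFam (Bier c M)) (suc k)) (m+[n∸m]≡n C≥1) ⟩
      hVec C (fFam (Bier c M)) (suc k)
    ≡⟨ h-Bier C≥1 (suc k) (≤-trans i≤C-1 (m∸n≤m C 1)) ⟩
      + fM c M (suc k) - + fM c M (C ∸ suc k)
    ∎
    where
    open ≡-Reasoning
    i≤C-1 : suc k ≤ C ∸ 1
    i≤C-1 = ≤-trans i≤ (m/n≤m (C ∸ 1) 2)
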